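{- The vector space $\mathbf{H}_{po}$ spanned by preordered forests, with the concatenation product, the cut coproduct $\Delta_{\mathbf{H}_{po}}$ and the counit $\varepsilon(F)=\delta_{F,1}$, is a Hopf algebra graded by the number of vertices. Moreover, the subspace $\mathbf{H}_{hpo}$ spanned by heap-preordered forests is a graded Hopf subalgebra of $\mathbf{H}_{po}$.
   Context: $\mathbb{K}$ is a field of characteristic zero. A rooted forest is a finite graph each of whose connected components is a tree with a distinguished vertex (its root); forests are considered up to isomorphism, and $1$ denotes the empty forest. Edges are oriented towards the roots; for vertices $v,w$ write $v\twoheadrightarrow w$ if there is an oriented path (possibly of length $0$) from $v$ to $w$. A preordered forest is a pair $(F,\sigma)$ where $F$ is a rooted forest and $\sigma:V(F)\to\{1,\dots,q\}$ is a surjection (equivalently a total preorder on $V(F)$; $q=\max(F)$), considered up to isomorphisms of rooted forests compatible with $\sigma$. The product of $(F,\sigma^F)$ and $(G,\sigma^G)$ is $(FG,\sigma^{FG})$, where $FG$ is the disjoint union, $\sigma^{FG}=\sigma^F$ on $V(F)$ and $\sigma^{FG}=\sigma^G+\max(F)$ on $V(G)$; it is extended bilinearly to the $\mathbb{K}$-vector space $\mathbf{H}_{po}$ with basis the preordered forests. A subforest induced on a set $W$ of vertices is preordered by restricting the preorder (i.e. restricting $\sigma$ to $W$ and composing with the increasing bijection from $\sigma(W)$ onto $\{1,\dots,|\sigma(W)|\}$). An admissible cut of $F$ is a subset $\boldsymbol{v}\subseteq V(F)$ such that no two distinct $v,w\in\boldsymbol{v}$ satisfy $v\twoheadrightarrow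 w$; $Lea_{\boldsymbol v}(F)$ is the preordered subforest induced on $\{w:\exists v\in\boldsymbol v,\ w\twoheadrightarrow v\}$ and $Roo_{\boldsymbol v}(F)$ the one induced on the remaining vertices. The cut coproduct is $\Delta_{\mathbf{H}_{po}}(F)=\sum_{\boldsymbol v\text{ admissible cut}}Lea_{\boldsymbol v}(F)\otimes Roo_{\boldsymbol v}(F)$. A heap-preordered forest is a preordered forest such that $a\neq b$ and $a\twoheadrightarrow b$ imply $\sigma(a)>\sigma(b)$. -}

module Defs where

open import Level using (_⊔_)
open import Algebra.Bundles using (CommutativeRing)
open import Data.Nat as ℕ using (ℕ; zero; suc)
open import Data.Bool as B using (Bool; true; false; not; if_then_else_)
open import Data.Fin as F using (Fin; splitAt; _↑ˡ_; _↑ʳ_)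
open import Data.Fin.Properties using (all?; any?; splitAt-↑ˡ; splitAt-↑ʳ; join-splitAt)
open import Data.Maybe as M using (Maybe; just; nothing; _>>=_)
open import Data.Maybe.Properties using (just-injective)
open import Data.Vec as V using (Vec; []; _∷_; lookup; tabulate)
open import Data.List as L using (List; []; _∷_; [_]; _++_)
open import Data.List.Relation.Unary.All using (All)
open import Data.Product using (Σ; _×_; _,_; proj₁; proj₂; ∃)
open import Data.Sum using (_⊎_; inj₁; inj₂)
open import Data.Empty using (⊥; ⊥-elim)
open import Relation.Nullary using (¬_; Dec; yes; no; does)
open import Relation.Nullary.Decidable.Core using (_×-dec_; _→-dec_; ¬?)
open import Relation.Binary.PropositionalEquality
  using (_≡_; _≢_; refl; sym; trans; cong; subst)
open import Induction.WellFounded using (Acc; acc; WellFounded)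

module _ {c ℓ} (K : CommutativeRing c ℓ) where
  open CommutativeRing K

  record IsField : Set (c ⊔ ℓ) where
    field
      1≉0     : ¬ (1# ≈ 0#)
      inverse : ∀ x → ¬ (x ≈ 0#) → Σ Carrier λ y → x * y ≈ 1#

  natK : ℕ → Carrier
  natK zero    = 0#
  natK (suc n) = 1# + natK n

  CharacteristicZero : Set ℓ
  CharacteristicZero = ∀ n → ¬ (natK (suc n) ≈ 0#)

-- Rooted forests on the vertex set Fin n, given by the partial
-- "parent" map (edges oriented towards the roots; the roots are the
-- vertices without parent).  Acyclicity = well-foundedness of
-- "y is the parent of x".

ParentOf : ∀ {n} → (Fin n → Maybe (Fin n)) → Fin n → Fin n → Set
ParentOf parent y x = parent x ≡ just y

module Paths {n} (parent : Fin n → Maybe (Fin n)) where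

  data _↠_ : Fin n → Fin n → Set where
    here  : ∀ {v} → v ↠ v
    there : ∀ {v p w} → parent v ≡ just p → p ↠ w → v ↠ w

  private
    noPath-root : ∀ {v w} → v ≢ w → parent v ≡ nothing → ¬ (v ↠ w)
    noPath-root v≢w e here         = v≢w refl
    noPath-root v≢w e (there e' r) with trans (sym e) e'
    ... | ()

    noPath-step : ∀ {v p w} → v ≢ w → parent v ≡ just p → ¬ (p ↠ w) → ¬ (v ↠ w)
    noPath-step v≢w e ¬r here         = v≢w refl
    noPath-step v≢w e ¬r (there e' r) =
      ¬r (subst (_↠ _) (just-injective (trans (sym e') e)) r)

  reach? : ∀ v w → Acc (ParentOf parent) v → Dec (v ↠ w)
  reach? v w (acc rs) with v F.≟ w
  ... | yes refl = yes here
  ... | no v≢w = aux (parent v) refl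
    where
    aux : (x : Maybe (Fin n)) → parent v ≡ x → Dec (v ↠ w)
    aux nothing  eq = no (noPath-root v≢w eq)
    aux (just p) eq with reach? p w (rs eq)
    ... | yes r = yes (there eq r)
    ... | no ¬r = no (noPath-step v≢w eq ¬r)

-- Preordered forests.  The surjection σ : V(F) → {1,…,q} is encoded,
-- equivalently, by the total preorder  le u v = true  ⇔  σ(u) ≤ σ(v).

record PForest : Set where
  field
    size     : ℕ
    parent   : Fin size → Maybe (Fin size)
    wf       : WellFounded (ParentOf parent)
    le       : Fin size → Fin size → Bool
    le-refl  : ∀ v → le v v ≡ true
    le-trans : ∀ u v w → le u v ≡ true → le v w ≡ true → le u w ≡ true
    le-total : ∀ u v → le u v ≡ true ⊎ le v u ≡ true

open PForest public

module _ (F : PForest) where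
  open Paths (parent F) public using (_↠_)

  _↠?_ : ∀ v w → Dec (v ↠ w)
  v ↠? w = Paths.reach? (parent F) v w (wf F v)

record _≅_ (F G : PForest) : Set where
  field
    to          : Fin (size F) → Fin (size G)
    from        : Fin (size G) → Fin (size F)
    from∘to     : ∀ v → from (to v) ≡ v
    to∘from     : ∀ w → to (from w) ≡ w
    parent-pres : ∀ v → parent G (to v) ≡ M.map to (parent F v)
    le-pres     : ∀ u v → le G (to u) (to v) ≡ le F u v

emptyF : PForest
emptyF = record
  { size = 0 ; parent = λ () ; wf = λ () ; le = λ ()
  ; le-refl = λ () ; le-trans = λ () ; le-total = λ () }

-- Product: disjoint union, with all vertices of F below all of G
-- (σ^{FG} = σ^F on F, σ^G + max(F) on G).

module Product (F G : PForest) where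
  n = size F
  m = size G

  par : Fin (n ℕ.+ m) → Maybe (Fin (n ℕ.+ m))
  par v with splitAt n v
  ... | inj₁ a = M.map (_↑ˡ m) (parent F a)
  ... | inj₂ b = M.map (n ↑ʳ_) (parent G b)

  leFG : Fin (n ℕ.+ m) → Fin (n ℕ.+ m) → Bool
  leFG u v with splitAt n u | splitAt n v
  ... | inj₁ a | inj₁ b = le F a b
  ... | inj₂ a | inj₂ b = le G a b
  ... | inj₁ _ | inj₂ _ = true
  ... | inj₂ _ | inj₁ _ = false

  private
    map-just : ∀ {A C : Set} (f : A → C) (x : Maybe A) {y} →
               M.map f x ≡ just y → Σ A λ a → x ≡ just a × f a ≡ y
    map-just f (just a) refl = a , refl , refl

    accL : ∀ a → Acc (ParentOf (parent F)) a → Acc (ParentOf par) (a ↑ˡ m)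
    accL a (acc rs) = acc λ {y} e → go y e
      where
      go : ∀ y → par (a ↑ˡ m) ≡ just y → Acc (ParentOf par) y
      go y e rewrite splitAt-↑ˡ n a m with map-just (_↑ˡ m) (parent F a) e
      ... | a' , e' , refl = accL a' (rs e')

    accR : ∀ b → Acc (ParentOf (parent G)) b → Acc (ParentOf par) (n ↑ʳ b)
    accR b (acc rs) = acc λ {y} e → go y e
      where
      go : ∀ y → par (n ↑ʳ b) ≡ just y → Acc (ParentOf par) y
      go y e rewrite splitAt-↑ʳ n m b with map-just (n ↑ʳ_) (parent G b) e
      ... | b' , e' , refl = accR b' (rs e')

    wfFG : WellFounded (ParentOf par)
    wfFG v with splitAt n v in eq
    ... | inj₁ a = subst (Acc (ParentOf par))
                     (trans (cong (F.join n m) (sym eq)) (join-splitAt n m v))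
                     (accL a (wf F a))
    ... | inj₂ b = subst (Acc (ParentOf par))
                     (trans (cong (F.join n m) (sym eq)) (join-splitAt n m v))
                     (accR b (wf G b))

    reflFG : ∀ v → leFG v v ≡ true
    reflFG v with splitAt n v
    ... | inj₁ a = le-refl F a
    ... | inj₂ b = le-refl G b

    transFG : ∀ u v w → leFG u v ≡ true → leFG v w ≡ true → leFG u w ≡ true
    transFG u v w with splitAt n u | splitAt n v | splitAt n w
    ... | inj₁ a | inj₁ b | inj₁ c = le-trans F a b c
    ... | inj₂ a | inj₂ b | inj₂ c = le-trans G a b c
    ... | inj₁ a | _      | inj₂ c = λ _ _ → refl
    ... | inj₁ a | inj₂ b | inj₁ c = λ _ ()
    ... | inj₂ a | inj₁ b | _      = λ ()
    ... | inj₂ a | inj₂ b | inj₁ c = λ _ ()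

    totalFG : ∀ u v → leFG u v ≡ true ⊎ leFG v u ≡ true
    totalFG u v with splitAt n u | splitAt n v
    ... | inj₁ a | inj₁ b = le-total F a b
    ... | inj₂ a | inj₂ b = le-total G a b
    ... | inj₁ _ | inj₂ _ = inj₁ refl
    ... | inj₂ _ | inj₁ _ = inj₂ refl

  prod : PForest
  prod = record
    { size = n ℕ.+ m ; parent = par ; wf = wfFG ; le = leFG
    ; le-refl = reflFG ; le-trans = transFG ; le-total = totalFG }

_·_ : PForest → PForest → PForest
F · G = Product.prod F G

count : ∀ {n} → Vec Bool n → ℕ
count []          = 0
count (true ∷ W)  = suc (count W)
count (false ∷ W) = count W

sub : ∀ {n} (W : Vec Bool n) → Fin (count W) → Fin n
sub (true ∷ W)  F.zero    = F.zero
sub (true ∷ W)  (F.suc i) = F.suc (sub W i)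
sub (false ∷ W) i         = F.suc (sub W i)

pos : ∀ {n} (W : Vec Bool n) → Fin n → Maybe (Fin (count W))
pos (true ∷ W)  F.zero    = just F.zero
pos (true ∷ W)  (F.suc v) = M.map F.suc (pos W v)
pos (false ∷ W) F.zero    = nothing
pos (false ∷ W) (F.suc v) = pos W v

sub-pos : ∀ {n} (W : Vec Bool n) v {j} → pos W v ≡ just j → sub W j ≡ v
sub-pos (true ∷ W)  F.zero    refl = refl
sub-pos (true ∷ W)  (F.suc v) e with pos W v in e'
sub-pos (true ∷ W)  (F.suc v) refl | just j = cong F.suc (sub-pos W v e')
sub-pos (false ∷ W) (F.suc v) e = cong F.suc (sub-pos W v e)

module Induced (F : PForest) (W : Vec Bool (size F)) where
  k = count W

  parW : Fin k → Maybe (Fin k)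
  parW i = parent F (sub W i) >>= pos W

  private
    bind-just : ∀ (x : Maybe (Fin (size F))) {j} → (x >>= pos W) ≡ just j →
                Σ (Fin (size F)) λ p → x ≡ just p × pos W p ≡ just j
    bind-just (just p) e = p , refl , e

    accW : ∀ i → Acc (ParentOf (parent F)) (sub W i) → Acc (ParentOf parW) i
    accW i (acc rs) = acc λ {j} e → go j e
      where
      go : ∀ j → parW i ≡ just j → Acc (ParentOf parW) j
      go j e with bind-just (parent F (sub W i)) e
      ... | p , e1 , e2 = accW j (rs (subst (λ z → parent F (sub W i) ≡ just z)
                                              (sym (sub-pos W p e2)) e1))

  induced : PForest
  induced = record
    { size = k ; parent = parW ; wf = λ i → accW i (wf F (sub W i))
    ; le = λ i j → le F (sub W i) (sub W j)
    ; le-refl = λ i → le-refl F (sub W i)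
    ; le-trans = λ i j l → le-trans F (sub W i) (sub W j) (sub W l)
    ; le-total = λ i j → le-total F (sub W i) (sub W j) }

allSubsets : ∀ n → List (Vec Bool n)
allSubsets zero    = [ [] ]
allSubsets (suc n) = L.map (true ∷_) (allSubsets n) L.++ L.map (false ∷_) (allSubsets n)

module Cuts (F : PForest) where
  n = size F

  Admissible : Vec Bool n → Set
  Admissible W = ∀ v w → lookup W v ≡ true → lookup W w ≡ true →
                 v ≢ w → ¬ (_↠_ F v w)

  admissible? : ∀ W → Dec (Admissible W)
  admissible? W = all? λ v → all? λ w →
    (lookup W v B.≟ true) →-dec (lookup W w B.≟ true) →-dec
    ¬? (v F.≟ w) →-dec ¬? (_↠?_ F v w)

  admissibleCuts : List (Vec Bool n)
  admissibleCuts = L.filter admissible? (allSubsets n)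

  leaSet : Vec Bool n → Vec Bool n
  leaSet W = tabulate λ w → does (any? λ v → (lookup W v B.≟ true) ×-dec (_↠?_ F w v))

  Lea Roo : Vec Bool n → PForest
  Lea W = Induced.induced F (leaSet W)
  Roo W = Induced.induced F (V.map not (leaSet W))

-- heap-preordered: a ≠ b, a ↠ b  ⇒  σ(a) > σ(b), i.e. not σ(a) ≤ σ(b)
IsHeap : PForest → Set
IsHeap F = ∀ a b → a ≢ b → _↠_ F a b → le F a b ≡ false

-- Free K-vector space on a set B modulo an equivalence ∼ on B
-- (here: preordered forests up to isomorphism).  Elements are formal
-- finite linear combinations (lists), and _≋_ is the congruence
-- generated by the vector-space identifications, so that
-- Lin B / ≋ ≅ ⊕_{[b] ∈ B/∼} K.

module Free {c ℓ} (K : CommutativeRing c ℓ) where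
  open CommutativeRing K

  Lin : Set → Set c
  Lin B = List (Carrier × B)

  data Eqv {B : Set} (_∼_ : B → B → Set) : Lin B → Lin B → Set (c ⊔ ℓ) where
    ≋-refl  : ∀ {u} → Eqv _∼_ u u
    ≋-sym   : ∀ {u v} → Eqv _∼_ u v → Eqv _∼_ v u
    ≋-trans : ∀ {u v w} → Eqv _∼_ u v → Eqv _∼_ v w → Eqv _∼_ u w
    ≋-++    : ∀ {u u' v v'} → Eqv _∼_ u u' → Eqv _∼_ v v' → Eqv _∼_ (u ++ v) (u' ++ v')
    ≋-swap  : ∀ x y → Eqv _∼_ (x ∷ y ∷ []) (y ∷ x ∷ [])
    ≋-merge : ∀ a a' b → Eqv _∼_ ((a , b) ∷ (a' , b) ∷ []) [ (a + a' , b) ]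
    ≋-zero  : ∀ b → Eqv _∼_ [ (0# , b) ] []
    ≋-coef  : ∀ {a a'} b → a ≈ a' → Eqv _∼_ [ (a , b) ] [ (a' , b) ]
    ≋-basis : ∀ a {b b'} → b ∼ b' → Eqv _∼_ [ (a , b) ] [ (a , b') ]

  scale : ∀ {B} → Carrier → Lin B → Lin B
  scale a = L.map λ { (x , b) → (a * x , b) }

  bind : ∀ {B C} → (B → Lin C) → Lin B → Lin C
  bind f []            = []
  bind f ((a , b) ∷ u) = scale a (f b) ++ bind f u

  evalK : ∀ {B} → (B → Carrier) → Lin B → Carrier
  evalK f []            = 0#
  evalK f ((a , b) ∷ u) = a * f b + evalK f u

module HPO {c ℓ} (K : CommutativeRing c ℓ) where
  open CommutativeRing K
  open Free K public

  _≅₂_ : PForest × PForest → PForest × PForest → Set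
  (F , G) ≅₂ (F' , G') = (F ≅ F') × (G ≅ G')

  _≅₃_ : PForest × (PForest × PForest) → PForest × (PForest × PForest) → Set
  (F , P) ≅₃ (F' , P') = (F ≅ F') × (P ≅₂ P')

  H H⊗H H⊗H⊗H : Set c
  H       = Lin PForest
  H⊗H     = Lin (PForest × PForest)
  H⊗H⊗H   = Lin (PForest × (PForest × PForest))

  _≈H_ : H → H → Set (c ⊔ ℓ)
  _≈H_ = Eqv _≅_
  _≈H₂_ : H⊗H → H⊗H → Set (c ⊔ ℓ)
  _≈H₂_ = Eqv _≅₂_
  _≈H₃_ : H⊗H⊗H → H⊗H⊗H → Set (c ⊔ ℓ)
  _≈H₃_ = Eqv _≅₃_

  basis : PForest → H
  basis F = [ (1# , F) ]

  one : H
  one = basis emptyF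

  mul : H → H → H
  mul u v = bind (λ F → bind (λ G → basis (F · G)) v) u

  Δb : PForest → H⊗H
  Δb F = L.map (λ W → (1# , (Cuts.Lea F W , Cuts.Roo F W))) (Cuts.admissibleCuts F)

  Δ : H → H⊗H
  Δ = bind Δb

  εb : PForest → Carrier
  εb F with size F
  ... | zero  = 1#
  ... | suc _ = 0#

  ε : H → Carrier
  ε = evalK εb

  one₂ : H⊗H
  one₂ = [ (1# , (emptyF , emptyF)) ]

  mul₂ : H⊗H → H⊗H → H⊗H
  mul₂ u v = bind (λ { (F , G) → bind (λ { (F' , G') → [ (1# , (F · F' , G · G')) ] }) v }) u

  Δ⊗id : H⊗H → H⊗H⊗H
  Δ⊗id = bind λ { (F , G) → L.map (λ { (x , (A , B)) → (x , (A , (B , G))) }) (Δb F) }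

  id⊗Δ : H⊗H → H⊗H⊗H
  id⊗Δ = bind λ { (F , G) → L.map (λ { (x , P) → (x , (F , P)) }) (Δb G) }

  ε⊗id : H⊗H → H
  ε⊗id = bind λ { (F , G) → [ (εb F , G) ] }

  id⊗ε : H⊗H → H
  id⊗ε = bind λ { (F , G) → [ (εb G , F) ] }

  m∘S⊗id : (PForest → H) → H⊗H → H
  m∘S⊗id S = bind λ { (F , G) → mul (S F) (basis G) }

  m∘id⊗S : (PForest → H) → H⊗H → H
  m∘id⊗S S = bind λ { (F , G) → mul (basis F) (S G) }

  η∘ε : H → H
  η∘ε u = scale (ε u) one

  InSpan : ∀ {B : Set} (_∼_ : B → B → Set) → (B → Set) → Lin B → Set (c ⊔ ℓ)
  InSpan _∼_ P u = Σ (Lin _) λ w → Eqv _∼_ u w × All (λ t → P (proj₂ t)) w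

  record Theorem : Set (c ⊔ ℓ) where
    field
      mul-cong : ∀ {u u' v v'} → u ≈H u' → v ≈H v' → mul u v ≈H mul u' v'
      Δ-cong   : ∀ {u u'} → u ≈H u' → Δ u ≈H₂ Δ u'
      ε-cong   : ∀ {u u'} → u ≈H u' → ε u ≈ ε u'
      mul-assoc : ∀ u v w → mul (mul u v) w ≈H mul u (mul v w)
      one-left  : ∀ u → mul one u ≈H u
      one-right : ∀ u → mul u one ≈H u
      coassoc    : ∀ u → Δ⊗id (Δ u) ≈H₃ id⊗Δ (Δ u)
      counit-left  : ∀ u → ε⊗id (Δ u) ≈H u
      counit-right : ∀ u → id⊗ε (Δ u) ≈H u
      Δ-mul : ∀ u v → Δ (mul u v) ≈H₂ mul₂ (Δ u) (Δ v)
      Δ-one : Δ one ≈H₂ one₂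
      ε-mul : ∀ u v → ε (mul u v) ≈ ε u * ε v
      ε-one : ε one ≈ 1#
      deg-mul : ∀ F G → size (F · G) ≡ size F ℕ.+ size G
      deg-one : size emptyF ≡ 0
      deg-Δ   : ∀ F → All (λ t → size (proj₁ (proj₂ t)) ℕ.+ size (proj₂ (proj₂ t)) ≡ size F) (Δb F)
      deg-ε   : ∀ F → size F ≢ 0 → εb F ≈ 0#
      heap-one : IsHeap emptyF
      heap-mul : ∀ F G → IsHeap F → IsHeap G → IsHeap (F · G)
      heap-Δ   : ∀ F → IsHeap F →
                 InSpan _≅₂_ (λ P → IsHeap (proj₁ P) × IsHeap (proj₂ P)) (Δb F)
      antipode : Σ (PForest → H) λ S →
        (∀ F G → F ≅ G → S F ≈H S G) ×
        (∀ u → m∘S⊗id S (Δ u) ≈H η∘ε u) ×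
        (∀ u → m∘id⊗S S (Δ u) ≈H η∘ε u) ×
        (∀ F → InSpan _≅_ (λ G → size G ≡ size F) (S F)) ×
        (∀ F → IsHeap F → InSpan _≅_ IsHeap (S F))

-- Admissible cuts of F correspond bijectively to the vertex sets closed under taking
-- descendants: a cut v gives the vertex set of Lea_v(F), and a closed set gives back its maximal
-- elements.  Hence Δ(F) = Σ_S F|S ⊗ F|∁S over closed sets S, and each Hopf algebra axiom becomes
-- a bijection between index sets: the closed sets of FG are the concatenations of closed sets of
-- F and of G (Δ is multiplicative), and both (Δ ⊗ id)Δ(F) and (id ⊗ Δ)Δ(F) are sums over chains
-- S₁ ⊆ S₂ of closed sets (coassociativity).  The preorders are only ever restricted, so they
-- are carried along by these bijections.  As Δ(F) = F ⊗ 1 + 1 ⊗ F + (terms with both sides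
-- smaller), an antipode is defined by recursion on the number of vertices; the left and right
-- recursions agree by associativity of convolution.  Induced subforests and products of
-- heap-preordered forests are heap-preordered, which makes H_hpo a Hopf subalgebra.

module Submission where

open import Defs
open import Algebra.Bundles using (CommutativeRing)
open import Data.Nat as ℕ using (ℕ; zero; suc; _≤_)
import Data.Nat.Properties as NP
open import Data.Bool as B using (Bool; true; false; not; if_then_else_; _∧_; _∨_)
open import Data.Bool.Properties using (not-involutive; ∧-identityʳ)
open import Data.Fin as Fin using (Fin; splitAt; _↑ˡ_; _↑ʳ_)
open import Data.Fin.Properties
  using (all?; any?; splitAt-↑ˡ; splitAt-↑ʳ; splitAt⁻¹-↑ˡ; splitAt⁻¹-↑ʳ; ↑ˡ-injective; ↑ʳ-injective; cantor-schröder-bernstein)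
open import Data.Maybe as M using (Maybe; just; nothing; _>>=_)
open import Data.Maybe.Properties using (just-injective)
open import Data.Vec as V using (Vec; []; _∷_; lookup; tabulate)
open import Data.Vec.Properties
  using (tabulate∘lookup; tabulate-cong; lookup∘tabulate; lookup-map; lookup-++ˡ; lookup-++ʳ; lookup-zipWith;
         lookup-replicate; map-replicate; map-++; ++-injective)
open import Data.List as L using (List; []; _∷_; [_]; _++_; concatMap)
open import Data.List.Properties as LP using ()
open import Data.List.Relation.Unary.All as All using (All; []; _∷_)
import Data.List.Relation.Unary.All.Properties as AllP
open import Data.List.Relation.Unary.Any using (here; there)
open import Data.List.Relation.Unary.AllPairs using ([]; _∷_)
open import Data.List.Relation.Unary.Unique.Propositional using (Unique)
import Data.List.Relation.Unary.Unique.Propositional.Properties as UP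
open import Data.List.Membership.Propositional using (_∈_)
open import Data.List.Membership.Propositional.Properties
  using (∈-∃++; ∈-++⁻; ∈-++⁺ˡ; ∈-++⁺ʳ; ∈-map⁺; ∈-map⁻; ∈-filter⁺; ∈-filter⁻)
open import Data.Product using (Σ; _×_; _,_; proj₁; proj₂; ∃)
open import Data.Sum using (_⊎_; inj₁; inj₂)
open import Data.Empty using (⊥-elim)
open import Relation.Nullary using (¬_; Dec; yes; no; does)
open import Relation.Nullary.Decidable using (_×-dec_; _→-dec_; dec-true)
open import Relation.Binary.PropositionalEquality as P
  using (_≡_; _≢_; refl; sym; trans; cong; subst)
open import Induction.WellFounded using (Acc; acc)
open Paths using (here; there)

induced : (F : PForest) → Vec Bool (size F) → PForest
induced = Induced.induced

ifZero : ∀ {a} {A : Set a} → ℕ → A → A → A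
ifZero zero x y = x
ifZero (suc _) x y = y

ifZero-zero : ∀ {a} {A : Set a} {n} (x y : A) → n ≡ 0 → ifZero n x y ≡ x
ifZero-zero x y refl = refl
ifZero-suc : ∀ {a} {A : Set a} {n m} (x y : A) → n ≡ suc m → ifZero n x y ≡ y
ifZero-suc x y refl = refl

All-delete : ∀ {A : Set} {Q : A → Set} as {b cs} → All Q (as ++ b ∷ cs) → All Q (as ++ cs) × Q b
All-delete [] (q ∷ qs) = qs , q
All-delete (a ∷ as) (q ∷ qs) = let r , s = All-delete as qs in (q ∷ r) , s

Unique-delete : ∀ {A : Set} as {b : A} {cs} → Unique (as ++ b ∷ cs) → Unique (as ++ cs) × All (b ≢_) (as ++ cs)
Unique-delete [] (p ∷ u) = u , p
Unique-delete (a ∷ as) (p ∷ u) =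
  let u' , q = Unique-delete as u
      p' , ab = All-delete as p
  in (p' ∷ u') , ((λ e → ab (P.sym e)) ∷ q)

∈-insert : ∀ {A : Set} as {b : A} {cs x} → x ∈ as ++ cs → x ∈ as ++ b ∷ cs
∈-insert as {cs = cs} m with ∈-++⁻ as m
... | inj₁ m' = ∈-++⁺ˡ m'
... | inj₂ m' = ∈-++⁺ʳ as (there m')

pairs : ∀ {A : Set} {Bf : A → Set} → List A → ((a : A) → List (Bf a)) → List (Σ A Bf)
pairs xs ys = concatMap (λ x → L.map (x ,_) (ys x)) xs

∈-pairs⁺ : ∀ {A : Set} {Bf : A → Set} {xs : List A} {ys : (a : A) → List (Bf a)} {x y} →
           x ∈ xs → y ∈ ys x → (x , y) ∈ pairs xs ys
∈-pairs⁺ {xs = x ∷ xs} {ys} (here refl) my = ∈-++⁺ˡ (∈-map⁺ (x ,_) my)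
∈-pairs⁺ {xs = x ∷ xs} {ys} (there mx) my = ∈-++⁺ʳ (L.map (x ,_) (ys x)) (∈-pairs⁺ mx my)

∈-pairs⁻ : ∀ {A : Set} {Bf : A → Set} {xs : List A} {ys : (a : A) → List (Bf a)} {p} →
           p ∈ pairs xs ys → proj₁ p ∈ xs × (proj₂ p ∈ ys (proj₁ p))
∈-pairs⁻ {xs = x ∷ xs} {ys} m with ∈-++⁻ (L.map (x ,_) (ys x)) m
... | inj₁ m1 with ∈-map⁻ (x ,_) m1
... | y , my , refl = here refl , my
∈-pairs⁻ {xs = x ∷ xs} {ys} m | inj₂ m2 = let a , b = ∈-pairs⁻ {xs = xs} m2 in there a , b

Unique-pairs : ∀ {A : Set} {Bf : A → Set} {xs : List A} {ys : (a : A) → List (Bf a)} →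
             Unique xs → (∀ x → Unique (ys x)) → Unique (pairs xs ys)
Unique-pairs {xs = []} u uy = []
Unique-pairs {A} {Bf} {xs = x ∷ xs} {ys} (p ∷ u) uy =
  UP.++⁺ (UP.map⁺ inj (uy x)) (Unique-pairs u uy) disj
  where
  inj : ∀ {y y' : Bf x} → (x , y) ≡ (x , y') → y ≡ y'
  inj refl = refl
  disj : ∀ {v} → ¬ (v ∈ L.map (x ,_) (ys x) × v ∈ pairs xs ys)
  disj (m1 , m2) with ∈-map⁻ (x ,_) m1
  ... | y , _ , refl = All.lookup p (proj₁ (∈-pairs⁻ {xs = xs} m2)) refl

concatMap-concatMap : ∀ {y} {X Z : Set} {Y : Set y} (f : Z → List Y) (g : X → List Z) xs →
            concatMap f (concatMap g xs) ≡ concatMap (λ x → concatMap f (g x)) xs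
concatMap-concatMap f g [] = refl
concatMap-concatMap f g (x ∷ xs) = P.trans (LP.concatMap-++ f (g x) (concatMap g xs))
      (cong (concatMap f (g x) ++_) (concatMap-concatMap f g xs))

concatMap-pairs : ∀ {y} {A : Set} {Bf : A → Set} {Y : Set y} (f : Σ A Bf → List Y) xs (ys : (a : A) → List (Bf a)) →
             concatMap f (pairs xs ys) ≡ concatMap (λ x → concatMap (λ z → f (x , z)) (ys x)) xs
concatMap-pairs f xs ys = P.trans (concatMap-concatMap f _ xs) (concatMap-pairs-ext xs)
  where
  concatMap-pairs-ext : ∀ zs → concatMap (λ x → concatMap f (L.map (x ,_) (ys x))) zs
                              ≡ concatMap (λ x → concatMap (λ z → f (x , z)) (ys x)) zs
  concatMap-pairs-ext [] = refl
  concatMap-pairs-ext (x ∷ zs) = P.cong₂ _++_ (LP.concatMap-map f (x ,_) (ys x)) (concatMap-pairs-ext zs)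

map≡concatMap : ∀ {y} {X : Set} {Y : Set y} (f : X → Y) xs → L.map f xs ≡ concatMap (λ x → [ f x ]) xs
map≡concatMap f [] = refl
map≡concatMap f (x ∷ xs) = cong (f x ∷_) (map≡concatMap f xs)

lookup-ext : ∀ {A : Set} {n} {xs ys : Vec A n} → (∀ i → lookup xs i ≡ lookup ys i) → xs ≡ ys
lookup-ext {xs = xs} {ys} e =
  trans (sym (tabulate∘lookup xs)) (trans (tabulate-cong e) (tabulate∘lookup ys))

map-∘ : ∀ {A B C : Set} (f : B → C) (g : A → B) (x : Maybe A) → M.map f (M.map g x) ≡ M.map (λ a → f (g a)) x
map-∘ f g nothing = refl
map-∘ f g (just x) = refl

map-id' : ∀ {A : Set} (f : A → A) → (∀ a → f a ≡ a) → (x : Maybe A) → M.map f x ≡ x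
map-id' f e nothing = refl
map-id' f e (just x) = cong just (e x)

≅-refl : ∀ {F} → F ≅ F
≅-refl {F} = record
  { to = λ v → v ; from = λ v → v ; from∘to = λ _ → refl ; to∘from = λ _ → refl
  ; parent-pres = λ v → sym (map-id' (λ x → x) (λ _ → refl) (parent F v)) ; le-pres = λ _ _ → refl }

≅-sym : ∀ {F G} → F ≅ G → G ≅ F
≅-sym {F} {G} φ = record
  { to = from ; from = to ; from∘to = to∘from ; to∘from = from∘to
  ; parent-pres = pp
  ; le-pres = λ u v → trans (sym (le-pres (from u) (from v)))
                          (P.cong₂ (le G) (to∘from u) (to∘from v)) }
  where
  open _≅_ φ
  pp : ∀ w → parent F (from w) ≡ M.map from (parent G w)
  pp w = sym (trans (cong (M.map from) (trans (sym (cong (parent G) (to∘from w))) (parent-pres (from w))))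
              (trans (map-∘ from to (parent F (from w))) (map-id' _ from∘to _)))

≅-trans : ∀ {F G H} → F ≅ G → G ≅ H → F ≅ H
≅-trans {F} {G} {H} φ ψ = record
  { to = λ v → Ψ.to (Φ.to v) ; from = λ w → Φ.from (Ψ.from w)
  ; from∘to = λ v → trans (cong Φ.from (Ψ.from∘to (Φ.to v))) (Φ.from∘to v)
  ; to∘from = λ w → trans (cong Ψ.to (Φ.to∘from (Ψ.from w))) (Ψ.to∘from w)
  ; parent-pres = λ v → trans (Ψ.parent-pres (Φ.to v))
      (trans (cong (M.map Ψ.to) (Φ.parent-pres v)) (map-∘ Ψ.to Φ.to (parent F v)))
  ; le-pres = λ u v → trans (Ψ.le-pres (Φ.to u) (Φ.to v)) (Φ.le-pres u v) }
  where
  module Φ = _≅_ φ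
  module Ψ = _≅_ ψ

iso-path : ∀ {F G} (φ : F ≅ G) {v w} → _↠_ F v w → _↠_ G (_≅_.to φ v) (_≅_.to φ w)
iso-path φ here = here
iso-path {F} {G} φ {v} (there {p = p} e r) =
  there (trans (_≅_.parent-pres φ v) (cong (M.map (_≅_.to φ)) e)) (iso-path φ r)

iso-size : ∀ {F G} → F ≅ G → size F ≡ size G
iso-size {F} {G} φ = cantor-schröder-bernstein {f = to} {g = from}
  (λ {x} {y} e → trans (sym (from∘to x)) (trans (cong from e) (from∘to y)))
  (λ {x} {y} e → trans (sym (to∘from x)) (trans (cong to e) (to∘from y)))
  where open _≅_ φ

-- Induced subforests

sub-in : ∀ {n} (W : Vec Bool n) i → lookup W (sub W i) ≡ true
sub-in (true ∷ W) Fin.zero = refl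
sub-in (true ∷ W) (Fin.suc i) = sub-in W i
sub-in (false ∷ W) i = sub-in W i

pos-sub : ∀ {n} (W : Vec Bool n) i → pos W (sub W i) ≡ just i
pos-sub (true ∷ W) Fin.zero = refl
pos-sub (true ∷ W) (Fin.suc i) = cong (M.map Fin.suc) (pos-sub W i)
pos-sub (false ∷ W) i = pos-sub W i

pos-out : ∀ {n} (W : Vec Bool n) v → lookup W v ≡ false → pos W v ≡ nothing
pos-out (true ∷ W) Fin.zero ()
pos-out (true ∷ W) (Fin.suc v) e = cong (M.map Fin.suc) (pos-out W v e)
pos-out (false ∷ W) Fin.zero e = refl
pos-out (false ∷ W) (Fin.suc v) e = pos-out W v e

sub-onto : ∀ {n} (W : Vec Bool n) v → lookup W v ≡ true → Σ (Fin (count W)) λ j → sub W j ≡ v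
sub-onto (true ∷ W) Fin.zero _ = Fin.zero , refl
sub-onto (true ∷ W) (Fin.suc v) e = let j , q = sub-onto W v e in Fin.suc j , cong Fin.suc q
sub-onto (false ∷ W) Fin.zero ()
sub-onto (false ∷ W) (Fin.suc v) e = let j , q = sub-onto W v e in j , cong Fin.suc q

sub-inj : ∀ {n} (W : Vec Bool n) {i j} → sub W i ≡ sub W j → i ≡ j
sub-inj W {i} {j} e = just-injective (trans (sym (pos-sub W i)) (trans (cong (pos W) e) (pos-sub W j)))

keep : ∀ {n} → Vec Bool n → Fin n → Maybe (Fin n)
keep W p = if lookup W p then just p else nothing

restr : ∀ {n} → Vec Bool n → Maybe (Fin n) → Maybe (Fin n)
restr W m = m >>= keep W

bind-just : ∀ {A C : Set} (x : Maybe A) (f : A → Maybe C) {j} → (x >>= f) ≡ just j →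
            Σ A λ p → x ≡ just p × f p ≡ just j
bind-just (just p) f e = p , refl , e

map-just : ∀ {A C : Set} (f : A → C) (x : Maybe A) {y} →
           M.map f x ≡ just y → Σ A λ a → x ≡ just a × f a ≡ y
map-just f (just a) refl = a , refl , refl

module InducedCharacterisation (F : PForest) (W : Vec Bool (size F)) (G : PForest)
  (e : Fin (size G) → Fin (size F))
  (e-inj : ∀ {x y} → e x ≡ e y → x ≡ y)
  (e-in : ∀ x → lookup W (e x) ≡ true)
  (e-onto : ∀ v → lookup W v ≡ true → Σ (Fin (size G)) λ x → e x ≡ v)
  (e-par : ∀ x → M.map e (parent G x) ≡ restr W (parent F (e x)))
  (e-le : ∀ x y → le G x y ≡ le F (e x) (e y)) where

  toI : Fin (size G) → Fin (count W)
  toI x = proj₁ (sub-onto W (e x) (e-in x))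
  toI-eq : ∀ x → sub W (toI x) ≡ e x
  toI-eq x = proj₂ (sub-onto W (e x) (e-in x))
  fromI : Fin (count W) → Fin (size G)
  fromI i = proj₁ (e-onto (sub W i) (sub-in W i))
  fromI-eq : ∀ i → e (fromI i) ≡ sub W i
  fromI-eq i = proj₂ (e-onto (sub W i) (sub-in W i))

  parent-pos : ∀ (m : Maybe (Fin (size F))) (y : Maybe (Fin (size G))) → M.map e y ≡ restr W m →
        (m >>= pos W) ≡ M.map toI y
  parent-pos nothing nothing h = refl
  parent-pos nothing (just _) ()
  parent-pos (just p) y h with lookup W p in eqp
  parent-pos (just p) nothing () | true
  parent-pos (just p) (just y') h | true =
    trans (cong (pos W) (trans (sym (just-injective h)) (sym (toI-eq y')))) (pos-sub W (toI y'))
  parent-pos (just p) nothing h | false = pos-out W p eqp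

  iso : G ≅ induced F W
  iso = record
    { to = toI ; from = fromI
    ; from∘to = λ x → e-inj (trans (fromI-eq (toI x)) (toI-eq x))
    ; to∘from = λ i → sub-inj W (trans (toI-eq (fromI i)) (fromI-eq i))
    ; parent-pres = λ x → trans (cong (λ z → parent F z >>= pos W) (toI-eq x))
                                (parent-pos (parent F (e x)) (parent G x) (e-par x))
    ; le-pres = λ x y → trans (P.cong₂ (le F) (toI-eq x) (toI-eq y)) (sym (e-le x y)) }

module _ (F : PForest) where
  private
    _⇝_ = _↠_ F

  path-++ : ∀ {a b c} → a ⇝ b → b ⇝ c → a ⇝ c
  path-++ here q = q
  path-++ (there e r) q = there e (path-++ r q)

  no-cycle : ∀ {v} → Acc (ParentOf (parent F)) v → ∀ {p} → parent F v ≡ just p → ¬ (p ⇝ v)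
  no-cycle (acc rs) e here = no-cycle (rs e) e here
  no-cycle (acc rs) e (there e2 r) = no-cycle (rs e) e2 (path-++ r (there e here))

module _ (F : PForest) (W : Vec Bool (size F)) where

  ind-path→ : ∀ {i j} → _↠_ (induced F W) i j → _↠_ F (sub W i) (sub W j)
  ind-path→ here = here
  ind-path→ {i} (there {p = j'} e r) with bind-just (parent F (sub W i)) (pos W) e
  ... | p , e1 , e2 = there (trans e1 (cong just (sym (sub-pos W p e2)))) (ind-path→ r)

  ind-path← : ∀ {v w} → _↠_ F v w → (∀ u → _↠_ F v u → _↠_ F u w → lookup W u ≡ true) →
              ∀ i j → sub W i ≡ v → sub W j ≡ w → _↠_ (induced F W) i j
  ind-path← here cv i j ei ej = subst (_↠_ (induced F W) i) (sub-inj W (trans ei (sym ej))) here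
  ind-path← {v} {w} (there {p = p} e r) cv i j refl ej =
    let pin = cv p (there e here) r
        k , ek = sub-onto W p pin
    in there (trans (cong (_>>= pos W) e) (trans (cong (pos W) (sym ek)) (pos-sub W k)))
             (ind-path← r (λ u pu uw → cv u (there e pu) uw) k j ek ej)

dec-true⁻ : ∀ {p} {Q : Set p} (d : Dec Q) → does d ≡ true → Q
dec-true⁻ (yes q) _ = q

true-or-false : ∀ (b : Bool) → b ≡ true ⊎ b ≡ false
true-or-false true = inj₁ refl
true-or-false false = inj₂ refl

true≢false : true ≢ false
true≢false ()

-- Closed vertex sets and admissible cuts

allSubsets-complete : ∀ {n} (W : Vec Bool n) → W ∈ allSubsets n
allSubsets-complete [] = here refl
allSubsets-complete {suc n} (true ∷ W) = ∈-++⁺ˡ (∈-map⁺ (true ∷_) (allSubsets-complete W))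
allSubsets-complete {suc n} (false ∷ W) =
  ∈-++⁺ʳ (L.map (true ∷_) (allSubsets n)) (∈-map⁺ (false ∷_) (allSubsets-complete W))

allSubsets-unique : ∀ n → Unique (allSubsets n)
allSubsets-unique zero = [] ∷ []
allSubsets-unique (suc n) =
  UP.++⁺ (UP.map⁺ (λ {x} {y} e → cong V.tail e) (allSubsets-unique n))
         (UP.map⁺ (λ {x} {y} e → cong V.tail e) (allSubsets-unique n))
         disj
  where
  disj : ∀ {v} → ¬ (v ∈ L.map (true ∷_) (allSubsets n) × v ∈ L.map (false ∷_) (allSubsets n))
  disj (m1 , m2) with ∈-map⁻ (true ∷_) m1 | ∈-map⁻ (false ∷_) m2
  ... | _ , _ , refl | _ , _ , ()

map⁺-injectiveOn : ∀ {A C : Set} (h : A → C) xs → Unique xs →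
              (∀ {x y} → x ∈ xs → y ∈ xs → h x ≡ h y → x ≡ y) → Unique (L.map h xs)
map⁺-injectiveOn h [] u inj = []
map⁺-injectiveOn h (x ∷ xs) (p ∷ u) inj =
  All.tabulate (λ {z} mz → aux z mz) ∷ map⁺-injectiveOn h xs u (λ mx my e → inj (there mx) (there my) e)
  where
  aux : ∀ z → z ∈ L.map h xs → h x ≢ z
  aux z mz e with ∈-map⁻ h mz
  ... | y , my , refl = All.lookup p my (inj (here refl) (there my) e)

count-not : ∀ {n} (S : Vec Bool n) → count S ℕ.+ count (V.map not S) ≡ n
count-not [] = refl
count-not (true ∷ S) = cong suc (count-not S)
count-not (false ∷ S) = trans (NP.+-suc (count S) _) (cong suc (count-not S))

module Cl (F : PForest) where
  n = size F
  _⇝_ = _↠_ F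

  Closed : Vec Bool n → Set
  Closed S = ∀ u v → u ⇝ v → lookup S v ≡ true → lookup S u ≡ true

  closed? : ∀ S → Dec (Closed S)
  closed? S = all? λ u → all? λ v → (_↠?_ F u v) →-dec ((lookup S v B.≟ true) →-dec (lookup S u B.≟ true))

  closedSets : List (Vec Bool n)
  closedSets = L.filter closed? (allSubsets n)

  closedSets-unique : Unique closedSets
  closedSets-unique = UP.filter⁺ closed? (allSubsets-unique n)

  ∈closed : ∀ {S} → Closed S → S ∈ closedSets
  ∈closed c = ∈-filter⁺ closed? (allSubsets-complete _) c

  closed∈ : ∀ {S} → S ∈ closedSets → Closed S
  closed∈ m = proj₂ (∈-filter⁻ closed? {xs = allSubsets n} m)

  open Cuts F using (Admissible; admissible?; admissibleCuts; leaSet)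

  cut∈ : ∀ {W} → W ∈ admissibleCuts → Admissible W
  cut∈ m = proj₂ (∈-filter⁻ admissible? {xs = allSubsets n} m)

  ∈cut : ∀ {W} → Admissible W → W ∈ admissibleCuts
  ∈cut a = ∈-filter⁺ admissible? (allSubsets-complete _) a

  cuts-unique : Unique admissibleCuts
  cuts-unique = UP.filter⁺ admissible? (allSubsets-unique n)

  leaFlag : Vec Bool n → Fin n → Bool
  leaFlag W w = does (any? λ v → (lookup W v B.≟ true) ×-dec (_↠?_ F w v))

  lea-intro : ∀ W {u v} → lookup W v ≡ true → u ⇝ v → lookup (leaSet W) u ≡ true
  lea-intro W {u} {v} e r = trans (lookup∘tabulate (leaFlag W) u)
    (dec-true (any? λ v → (lookup W v B.≟ true) ×-dec (_↠?_ F u v)) (v , e , r))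

  lea-elim : ∀ W {u} → lookup (leaSet W) u ≡ true → Σ (Fin n) λ v → lookup W v ≡ true × u ⇝ v
  lea-elim W {u} e = dec-true⁻ (any? λ v → (lookup W v B.≟ true) ×-dec (_↠?_ F u v))
                       (trans (sym (lookup∘tabulate (leaFlag W) u)) e)

  leaSet-closed : ∀ W → Closed (leaSet W)
  leaSet-closed W u v r e with lea-elim W e
  ... | w , ew , rw = lea-intro W ew (path-++ F r rw)

  parentOutside : Vec Bool n → Maybe (Fin n) → Bool
  parentOutside S nothing = true
  parentOutside S (just p) = not (lookup S p)

  maxOf : Vec Bool n → Vec Bool n
  maxOf S = tabulate λ v → lookup S v ∧ parentOutside S (parent F v)

  maxOf-elim : ∀ S v → lookup (maxOf S) v ≡ true →
               lookup S v ≡ true × (∀ p → parent F v ≡ just p → lookup S p ≡ false)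
  maxOf-elim S v e with lookup S v | trans (sym (lookup∘tabulate (λ v → lookup S v ∧ parentOutside S (parent F v)) v)) e
  ... | true | e' = refl , λ p ep → aux (parent F v) e' p ep
    where
    aux : ∀ m → parentOutside S m ≡ true → ∀ p → m ≡ just p → lookup S p ≡ false
    aux (just q) h p refl with lookup S q
    aux (just q) () p refl | true
    ... | false = refl

  maxOf-intro : ∀ S v → lookup S v ≡ true → (∀ p → parent F v ≡ just p → lookup S p ≡ false) →
                lookup (maxOf S) v ≡ true
  maxOf-intro S v e h = trans (lookup∘tabulate (λ v → lookup S v ∧ parentOutside S (parent F v)) v)
    (trans (cong (_∧ parentOutside S (parent F v)) e) (aux (parent F v) (λ p ep → h p ep)))
    where
    aux : ∀ m → (∀ p → m ≡ just p → lookup S p ≡ false) → parentOutside S m ≡ true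
    aux nothing _ = refl
    aux (just q) h' = cong not (h' q refl)

  maxOf-admissible : ∀ S → Closed S → Admissible (maxOf S)
  maxOf-admissible S c v w ev ew v≢w here = v≢w refl
  maxOf-admissible S c v w ev ew v≢w (there {p = p} e r) =
    true≢false (trans (sym (c p w r (proj₁ (maxOf-elim S w ew)))) (proj₂ (maxOf-elim S v ev) p e))

  climb-to-maxOf : ∀ S u → Acc (ParentOf (parent F)) u → lookup S u ≡ true →
          Σ (Fin n) λ v → lookup (maxOf S) v ≡ true × u ⇝ v
  climb-to-maxOf S u (acc rs) e = aux (parent F u) refl
    where
    aux : ∀ m → parent F u ≡ m → Σ (Fin n) λ v → lookup (maxOf S) v ≡ true × u ⇝ v
    aux nothing eq = u , maxOf-intro S u e (λ p ep → ⊥-elim (nj (trans (sym eq) ep))) , here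
      where nj : ∀ {p} → nothing ≢ just p
            nj ()
    aux (just p) eq with true-or-false (lookup S p)
    ... | inj₂ f = u , maxOf-intro S u e (λ p' ep → subst (λ z → lookup S z ≡ false)
                      (just-injective (trans (sym eq) ep)) f) , here
    ... | inj₁ t with climb-to-maxOf S p (rs eq) t
    ... | v , mv , r = v , mv , there eq r

  leaSet-maxOf : ∀ S → Closed S → leaSet (maxOf S) ≡ S
  leaSet-maxOf S c = lookup-ext λ u → pointwise u
    where
    pointwise : ∀ u → lookup (leaSet (maxOf S)) u ≡ lookup S u
    pointwise u with true-or-false (lookup S u)
    ... | inj₁ t = let v , mv , r = climb-to-maxOf S u (wf F u) t in trans (lea-intro (maxOf S) mv r) (sym t)
    ... | inj₂ f with true-or-false (lookup (leaSet (maxOf S)) u)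
    ... | inj₂ f' = trans f' (sym f)
    ... | inj₁ t' = let v , mv , r = lea-elim (maxOf S) t' in
                    ⊥-elim (true≢false (trans (sym (c u v r (proj₁ (maxOf-elim S v mv)))) f))

  maxOf-leaSet : ∀ W → Admissible W → maxOf (leaSet W) ≡ W
  maxOf-leaSet W a = lookup-ext λ v → pointwise v
    where
    pointwise : ∀ v → lookup (maxOf (leaSet W)) v ≡ lookup W v
    pointwise v with true-or-false (lookup W v)
    ... | inj₁ t = trans (maxOf-intro (leaSet W) v (lea-intro W t here) h) (sym t)
      where
      h : ∀ p → parent F v ≡ just p → lookup (leaSet W) p ≡ false
      h p ep with true-or-false (lookup (leaSet W) p)
      ... | inj₂ f = f
      ... | inj₁ t' with lea-elim W t'
      ... | w , ew , r with v Fin.≟ w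
      ... | yes refl = ⊥-elim (no-cycle F (wf F v) ep r)
      ... | no v≢w = ⊥-elim (a v w t ew v≢w (there ep r))
    ... | inj₂ f with true-or-false (lookup (maxOf (leaSet W)) v)
    ... | inj₂ f' = trans f' (sym f)
    ... | inj₁ t' with maxOf-elim (leaSet W) v t'
    ... | inl , h with lea-elim W inl
    ... | w , ew , here = ⊥-elim (true≢false (trans (sym ew) f))
    ... | w , ew , there {p = p} ep r = ⊥-elim (true≢false (trans (sym (lea-intro W ew r)) (h p ep)))

-- Products of preordered forests

module Prod (F G : PForest) where
  n = size F
  m = size G
  FG = F · G

  par-L : ∀ a → parent FG (a ↑ˡ m) ≡ M.map (_↑ˡ m) (parent F a)
  par-L a rewrite splitAt-↑ˡ n a m = refl
  par-R : ∀ b → parent FG (n ↑ʳ b) ≡ M.map (n ↑ʳ_) (parent G b)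
  par-R b rewrite splitAt-↑ʳ n m b = refl
  le-LL : ∀ a a' → le FG (a ↑ˡ m) (a' ↑ˡ m) ≡ le F a a'
  le-LL a a' rewrite splitAt-↑ˡ n a m | splitAt-↑ˡ n a' m = refl
  le-RR : ∀ b b' → le FG (n ↑ʳ b) (n ↑ʳ b') ≡ le G b b'
  le-RR b b' rewrite splitAt-↑ʳ n m b | splitAt-↑ʳ n m b' = refl
  le-LR : ∀ a b → le FG (a ↑ˡ m) (n ↑ʳ b) ≡ true
  le-LR a b rewrite splitAt-↑ˡ n a m | splitAt-↑ʳ n m b = refl
  le-RL : ∀ a b → le FG (n ↑ʳ b) (a ↑ˡ m) ≡ false
  le-RL a b rewrite splitAt-↑ˡ n a m | splitAt-↑ʳ n m b = refl

  data View : Fin (n ℕ.+ m) → Set where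
    isL : ∀ a → View (a ↑ˡ m)
    isR : ∀ b → View (n ↑ʳ b)

  view : ∀ v → View v
  view v with splitAt n v in eq
  ... | inj₁ a = subst View (splitAt⁻¹-↑ˡ eq) (isL a)
  ... | inj₂ b = subst View (splitAt⁻¹-↑ʳ eq) (isR b)

  L≢R : ∀ a b → a ↑ˡ m ≢ n ↑ʳ b
  L≢R a b e with trans (sym (splitAt-↑ˡ n a m)) (trans (cong (splitAt n) e) (splitAt-↑ʳ n m b))
  ... | ()

  pathL : ∀ {a a'} → _↠_ F a a' → _↠_ FG (a ↑ˡ m) (a' ↑ˡ m)
  pathL here = here
  pathL {a} (there e r) = there (trans (par-L a) (cong (M.map _) e)) (pathL r)
  pathR : ∀ {b b'} → _↠_ G b b' → _↠_ FG (n ↑ʳ b) (n ↑ʳ b')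
  pathR here = here
  pathR {b} (there e r) = there (trans (par-R b) (cong (M.map _) e)) (pathR r)

  pathL⁻ : ∀ {v w} → _↠_ FG v w → ∀ a → v ≡ a ↑ˡ m → Σ (Fin n) λ a' → w ≡ a' ↑ˡ m × _↠_ F a a'
  pathL⁻ here a e = a , e , here
  pathL⁻ (there {p = p} e r) a refl with map-just (_↑ˡ m) (parent F a) (trans (sym (par-L a)) e)
  ... | a1 , e1 , refl with pathL⁻ r a1 refl
  ... | a' , ew , r' = a' , ew , there e1 r'

  pathR⁻ : ∀ {v w} → _↠_ FG v w → ∀ b → v ≡ n ↑ʳ b → Σ (Fin m) λ b' → w ≡ n ↑ʳ b' × _↠_ G b b'
  pathR⁻ here b e = b , e , here
  pathR⁻ (there {p = p} e r) b refl with map-just (n ↑ʳ_) (parent G b) (trans (sym (par-R b)) e)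
  ... | b1 , e1 , refl with pathR⁻ r b1 refl
  ... | b' , ew , r' = b' , ew , there e1 r'

  pathLL⁻ : ∀ {a a'} → _↠_ FG (a ↑ˡ m) (a' ↑ˡ m) → _↠_ F a a'
  pathLL⁻ {a} {a'} r with pathL⁻ r a refl
  ... | a'' , e , r' = subst (_↠_ F a) (sym (↑ˡ-injective m a' a'' e)) r'
  pathRR⁻ : ∀ {b b'} → _↠_ FG (n ↑ʳ b) (n ↑ʳ b') → _↠_ G b b'
  pathRR⁻ {b} {b'} r with pathR⁻ r b refl
  ... | b'' , e , r' = subst (_↠_ G b) (sym (↑ʳ-injective n b' b'' e)) r'
  pathLR⁻ : ∀ {a b} → ¬ _↠_ FG (a ↑ˡ m) (n ↑ʳ b)
  pathLR⁻ {a} {b} r with pathL⁻ r a refl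
  ... | a'' , e , _ = L≢R a'' b (sym e)
  pathRL⁻ : ∀ {a b} → ¬ _↠_ FG (n ↑ʳ b) (a ↑ˡ m)
  pathRL⁻ {a} {b} r with pathR⁻ r b refl
  ... | b'' , e , _ = L≢R a b'' e

  heap-· : IsHeap F → IsHeap G → IsHeap FG
  heap-· hF hG u v u≢v r with view u | view v
  ... | isL a | isL a' = trans (le-LL a a') (hF a a' (λ e → u≢v (cong (_↑ˡ m) e)) (pathLL⁻ r))
  ... | isR b | isR b' = trans (le-RR b b') (hG b b' (λ e → u≢v (cong (n ↑ʳ_) e)) (pathRR⁻ r))
  ... | isL a | isR b = ⊥-elim (pathLR⁻ r)
  ... | isR b | isL a = le-RL a b

  closed-++ : ∀ (S : Vec Bool n) (S' : Vec Bool m) → Cl.Closed F S → Cl.Closed G S' → Cl.Closed FG (S V.++ S')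
  closed-++ S S' c c' u v r e with view u | view v
  ... | isL a | isL a' = trans (lookup-++ˡ S S' a) (c a a' (pathLL⁻ r) (trans (sym (lookup-++ˡ S S' a')) e))
  ... | isR b | isR b' = trans (lookup-++ʳ S S' b) (c' b b' (pathRR⁻ r) (trans (sym (lookup-++ʳ S S' b')) e))
  ... | isL a | isR b = ⊥-elim (pathLR⁻ r)
  ... | isR b | isL a = ⊥-elim (pathRL⁻ r)

  closed-++⁻ : ∀ (S : Vec Bool n) (S' : Vec Bool m) → Cl.Closed FG (S V.++ S') → Cl.Closed F S × Cl.Closed G S'
  closed-++⁻ S S' c =
    (λ a a' r e → trans (sym (lookup-++ˡ S S' a)) (c _ _ (pathL r) (trans (lookup-++ˡ S S' a') e))) ,
    (λ b b' r e → trans (sym (lookup-++ʳ S S' b)) (c _ _ (pathR r) (trans (lookup-++ʳ S S' b') e)))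

map-cong : ∀ {A C : Set} {f g : A → C} → (∀ a → f a ≡ g a) → ∀ x → M.map f x ≡ M.map g x
map-cong e nothing = refl
map-cong e (just a) = cong just (e a)

module ProductCharacterisation (A B X : PForest)
  (eA : Fin (size A) → Fin (size X)) (eB : Fin (size B) → Fin (size X))
  (eA-inj : ∀ {a a'} → eA a ≡ eA a' → a ≡ a')
  (eB-inj : ∀ {b b'} → eB b ≡ eB b' → b ≡ b')
  (disj : ∀ a b → eA a ≢ eB b)
  (cover : ∀ x → (Σ (Fin (size A)) λ a → eA a ≡ x) ⊎ (Σ (Fin (size B)) λ b → eB b ≡ x))
  (parA : ∀ a → parent X (eA a) ≡ M.map eA (parent A a))
  (parB : ∀ b → parent X (eB b) ≡ M.map eB (parent B b))
  (leAA : ∀ a a' → le X (eA a) (eA a') ≡ le A a a')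
  (leBB : ∀ b b' → le X (eB b) (eB b') ≡ le B b b')
  (leAB : ∀ a b → le X (eA a) (eB b) ≡ true)
  (leBA : ∀ a b → le X (eB b) (eA a) ≡ false) where

  open Prod A B
  toP : Fin (n ℕ.+ m) → Fin (size X)
  toP v with splitAt n v
  ... | inj₁ a = eA a
  ... | inj₂ b = eB b

  to-L : ∀ a → toP (a ↑ˡ m) ≡ eA a
  to-L a rewrite splitAt-↑ˡ n a m = refl
  to-R : ∀ b → toP (n ↑ʳ b) ≡ eB b
  to-R b rewrite splitAt-↑ʳ n m b = refl

  fromP : Fin (size X) → Fin (n ℕ.+ m)
  fromP x with cover x
  ... | inj₁ (a , _) = a ↑ˡ m
  ... | inj₂ (b , _) = n ↑ʳ b

  from-A : ∀ a → fromP (eA a) ≡ a ↑ˡ m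
  from-A a with cover (eA a)
  ... | inj₁ (a' , e) = cong (_↑ˡ m) (eA-inj e)
  ... | inj₂ (b , e) = ⊥-elim (disj a b (sym e))
  from-B : ∀ b → fromP (eB b) ≡ n ↑ʳ b
  from-B b with cover (eB b)
  ... | inj₁ (a , e) = ⊥-elim (disj a b e)
  ... | inj₂ (b' , e) = cong (n ↑ʳ_) (eB-inj e)

  iso : (A · B) ≅ X
  iso = record
    { to = toP ; from = fromP
    ; from∘to = ft
    ; to∘from = tf
    ; parent-pres = pp
    ; le-pres = lp }
    where
    ft : ∀ v → fromP (toP v) ≡ v
    ft v with view v
    ... | isL a = trans (cong fromP (to-L a)) (from-A a)
    ... | isR b = trans (cong fromP (to-R b)) (from-B b)
    tf : ∀ x → toP (fromP x) ≡ x
    tf x with cover x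
    ... | inj₁ (a , e) = trans (to-L a) e
    ... | inj₂ (b , e) = trans (to-R b) e
    pp : ∀ v → parent X (toP v) ≡ M.map toP (parent (A · B) v)
    pp v with view v
    ... | isL a = trans (cong (parent X) (to-L a)) (trans (parA a)
                  (sym (trans (cong (M.map toP) (par-L a)) (trans (map-∘ toP (_↑ˡ m) (parent A a))
                    (map-cong to-L (parent A a))))))
    ... | isR b = trans (cong (parent X) (to-R b)) (trans (parB b)
                  (sym (trans (cong (M.map toP) (par-R b)) (trans (map-∘ toP (n ↑ʳ_) (parent B b))
                    (map-cong to-R (parent B b))))))
    lp : ∀ u v → le X (toP u) (toP v) ≡ le (A · B) u v
    lp u v with view u | view v
    ... | isL a | isL a' = trans (P.cong₂ (le X) (to-L a) (to-L a')) (trans (leAA a a') (sym (le-LL a a')))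
    ... | isR b | isR b' = trans (P.cong₂ (le X) (to-R b) (to-R b')) (trans (leBB b b') (sym (le-RR b b')))
    ... | isL a | isR b = trans (P.cong₂ (le X) (to-L a) (to-R b)) (trans (leAB a b) (sym (le-LR a b)))
    ... | isR b | isL a = trans (P.cong₂ (le X) (to-R b) (to-L a)) (trans (leBA a b) (sym (le-RL a b)))

·-cong : ∀ {A A' B B'} → A ≅ A' → B ≅ B' → (A · B) ≅ (A' · B')
·-cong {A} {A'} {B} {B'} φ ψ = ProductCharacterisation.iso A B (A' · B') eA eB eA-inj eB-inj disj cover parA parB leAA leBB
      leAB leBA
  where
  module Φ = _≅_ φ
  module Ψ = _≅_ ψ
  open Prod A' B'
  eA = λ a → Φ.to a ↑ˡ m
  eB = λ b → n ↑ʳ Ψ.to b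
  eA-inj : ∀ {a a'} → eA a ≡ eA a' → a ≡ a'
  eA-inj {a} {a'} e = trans (sym (Φ.from∘to a)) (trans (cong Φ.from (↑ˡ-injective m _ _ e)) (Φ.from∘to a'))
  eB-inj : ∀ {b b'} → eB b ≡ eB b' → b ≡ b'
  eB-inj {b} {b'} e = trans (sym (Ψ.from∘to b)) (trans (cong Ψ.from (↑ʳ-injective n _ _ e)) (Ψ.from∘to b'))
  disj : ∀ a b → eA a ≢ eB b
  disj a b = L≢R _ _
  cover : ∀ x → (Σ _ λ a → eA a ≡ x) ⊎ (Σ _ λ b → eB b ≡ x)
  cover x with view x
  ... | isL a' = inj₁ (Φ.from a' , cong (_↑ˡ m) (Φ.to∘from a'))
  ... | isR b' = inj₂ (Ψ.from b' , cong (n ↑ʳ_) (Ψ.to∘from b'))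
  parA : ∀ a → parent (A' · B') (eA a) ≡ M.map eA (parent A a)
  parA a = trans (par-L (Φ.to a)) (trans (cong (M.map _) (Φ.parent-pres a)) (map-∘ _ _ (parent A a)))
  parB : ∀ b → parent (A' · B') (eB b) ≡ M.map eB (parent B b)
  parB b = trans (par-R (Ψ.to b)) (trans (cong (M.map _) (Ψ.parent-pres b)) (map-∘ _ _ (parent B b)))
  leAA = λ a a' → trans (le-LL _ _) (Φ.le-pres a a')
  leBB = λ b b' → trans (le-RR _ _) (Ψ.le-pres b b')
  leAB = λ a b → le-LR _ _
  leBA = λ a b → le-RL _ _

·-assoc : ∀ A B C → ((A · B) · C) ≅ (A · (B · C))
·-assoc A B C = ProductCharacterisation.iso (A · B) C X eA eB eA-inj eB-inj disj cover parA parB leAA leBB leAB leBA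
  where
  module P1 = Prod A B
  module P2 = Prod B C
  module P3 = Prod A (B · C)
  X = A · (B · C)
  a = size A
  b = size B
  c = size C
  eA : Fin (a ℕ.+ b) → Fin (a ℕ.+ (b ℕ.+ c))
  eA v with splitAt a v
  ... | inj₁ i = i ↑ˡ (b ℕ.+ c)
  ... | inj₂ j = a ↑ʳ (j ↑ˡ c)
  eA-L : ∀ i → eA (i ↑ˡ b) ≡ i ↑ˡ (b ℕ.+ c)
  eA-L i rewrite splitAt-↑ˡ a i b = refl
  eA-R : ∀ j → eA (a ↑ʳ j) ≡ a ↑ʳ (j ↑ˡ c)
  eA-R j rewrite splitAt-↑ʳ a b j = refl
  eB : Fin c → Fin (a ℕ.+ (b ℕ.+ c))
  eB k = a ↑ʳ (b ↑ʳ k)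
  eA-inj : ∀ {u u'} → eA u ≡ eA u' → u ≡ u'
  eA-inj {u} {u'} e with P1.view u | P1.view u'
  ... | P1.isL i | P1.isL i' = cong (_↑ˡ b) (↑ˡ-injective _ i i' (trans (sym (eA-L i)) (trans e (eA-L i'))))
  ... | P1.isR j | P1.isR j' = cong (a ↑ʳ_) (↑ˡ-injective c j j' (↑ʳ-injective a _ _ (trans (sym (eA-R j)) (trans e (eA-R j')))))
  ... | P1.isL i | P1.isR j = ⊥-elim (P3.L≢R i _ (trans (sym (eA-L i)) (trans e (eA-R j))))
  ... | P1.isR j | P1.isL i = ⊥-elim (P3.L≢R i _ (sym (trans (sym (eA-R j)) (trans e (eA-L i)))))
  eB-inj : ∀ {k k'} → eB k ≡ eB k' → k ≡ k'
  eB-inj e = ↑ʳ-injective b _ _ (↑ʳ-injective a _ _ e)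
  disj : ∀ u k → eA u ≢ eB k
  disj u k e with P1.view u
  ... | P1.isL i = P3.L≢R i _ (trans (sym (eA-L i)) e)
  ... | P1.isR j = P2.L≢R j k (↑ʳ-injective a _ _ (trans (sym (eA-R j)) e))
  cover : ∀ x → (Σ _ λ u → eA u ≡ x) ⊎ (Σ _ λ k → eB k ≡ x)
  cover x with P3.view x
  ... | P3.isL i = inj₁ (i ↑ˡ b , eA-L i)
  ... | P3.isR y with P2.view y
  ... | P2.isL j = inj₁ (a ↑ʳ j , eA-R j)
  ... | P2.isR k = inj₂ (k , refl)
  parA : ∀ u → parent X (eA u) ≡ M.map eA (parent (A · B) u)
  parA u with P1.view u
  ... | P1.isL i = trans (cong (parent X) (eA-L i)) (trans (P3.par-L i)
                   (sym (trans (cong (M.map eA) (P1.par-L i))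
                         (trans (map-∘ eA (_↑ˡ b) (parent A i)) (map-cong eA-L (parent A i))))))
  ... | P1.isR j = trans (cong (parent X) (eA-R j)) (trans (P3.par-R (j ↑ˡ c))
                   (trans (cong (M.map (a ↑ʳ_)) (P2.par-L j)) (trans (map-∘ _ _ (parent B j))
                   (sym (trans (cong (M.map eA) (P1.par-R j))
                         (trans (map-∘ eA (a ↑ʳ_) (parent B j)) (map-cong eA-R (parent B j))))))))
  parB : ∀ k → parent X (eB k) ≡ M.map eB (parent C k)
  parB k = trans (P3.par-R (b ↑ʳ k)) (trans (cong (M.map (a ↑ʳ_)) (P2.par-R k)) (map-∘ _ _ (parent C k)))
  leAA : ∀ u u' → le X (eA u) (eA u') ≡ le (A · B) u u'
  leAA u u' with P1.view u | P1.view u'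
  ... | P1.isL i | P1.isL i' = trans (P.cong₂ (le X) (eA-L i) (eA-L i')) (trans (P3.le-LL i i') (sym (P1.le-LL i i')))
  ... | P1.isR j | P1.isR j' = trans (P.cong₂ (le X) (eA-R j) (eA-R j'))
        (trans (P3.le-RR _ _) (trans (P2.le-LL j j') (sym (P1.le-RR j j'))))
  ... | P1.isL i | P1.isR j = trans (P.cong₂ (le X) (eA-L i) (eA-R j)) (trans (P3.le-LR _ _) (sym (P1.le-LR i j)))
  ... | P1.isR j | P1.isL i = trans (P.cong₂ (le X) (eA-R j) (eA-L i)) (trans (P3.le-RL _ _) (sym (P1.le-RL i j)))
  leBB : ∀ k k' → le X (eB k) (eB k') ≡ le C k k'
  leBB k k' = trans (P3.le-RR _ _) (P2.le-RR k k')
  leAB : ∀ u k → le X (eA u) (eB k) ≡ true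
  leAB u k with P1.view u
  ... | P1.isL i = trans (cong (λ z → le X z (eB k)) (eA-L i)) (P3.le-LR _ _)
  ... | P1.isR j = trans (cong (λ z → le X z (eB k)) (eA-R j)) (trans (P3.le-RR _ _) (P2.le-LR j k))
  leBA : ∀ u k → le X (eB k) (eA u) ≡ false
  leBA u k with P1.view u
  ... | P1.isL i = trans (cong (le X (eB k)) (eA-L i)) (P3.le-RL _ _)
  ... | P1.isR j = trans (cong (le X (eB k)) (eA-R j)) (trans (P3.le-RR _ _) (P2.le-RL j k))

Fin0-elim : ∀ {A : Set} → Fin 0 → A
Fin0-elim ()

size0-elim : ∀ {A : Set} (F : PForest) → size F ≡ 0 → Fin (size F) → A
size0-elim F e v = Fin0-elim (subst Fin e v)

size≡0⇒≅ : ∀ F G → size F ≡ 0 → size G ≡ 0 → F ≅ G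
size≡0⇒≅ F G e e' = record
  { to = size0-elim F e ; from = size0-elim G e'
  ; from∘to = λ v → size0-elim F e v ; to∘from = λ v → size0-elim G e' v
  ; parent-pres = λ v → size0-elim F e v ; le-pres = λ u v → size0-elim F e u }

·-identityˡ : ∀ G → (emptyF · G) ≅ G
·-identityˡ G = ProductCharacterisation.iso emptyF G G Fin0-elim (λ b → b) (λ {a} → Fin0-elim a) (λ e → e)
  (λ a → Fin0-elim a) (λ x → inj₂ (x , refl)) (λ a → Fin0-elim a)
  (λ b → sym (map-id' (λ x → x) (λ _ → refl) (parent G b)))
  (λ a → Fin0-elim a) (λ _ _ → refl) (λ a → Fin0-elim a) (λ a → Fin0-elim a)

·-identityʳ : ∀ G → (G · emptyF) ≅ G
·-identityʳ G = ProductCharacterisation.iso G emptyF G (λ b → b) Fin0-elim (λ e → e) (λ {a} → Fin0-elim a)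
  (λ a b → Fin0-elim b) (λ x → inj₁ (x , refl))
  (λ b → sym (map-id' (λ x → x) (λ _ → refl) (parent G b))) (λ a → Fin0-elim a)
  (λ _ _ → refl) (λ a → Fin0-elim a) (λ a b → Fin0-elim b) (λ a b → Fin0-elim b)

pos-just : ∀ {n} (S : Vec Bool n) p (t : lookup S p ≡ true) → pos S p ≡ just (proj₁ (sub-onto S p t))
pos-just S p t = trans (cong (pos S) (sym (proj₂ (sub-onto S p t)))) (pos-sub S _)

map-sub-pos≡restr : ∀ {n k} (S : Vec Bool n) (f : Fin n → Fin k) (W' : Vec Bool k) →
         (∀ p → lookup W' (f p) ≡ lookup S p) → ∀ m0 →
         M.map (λ i → f (sub S i)) (m0 >>= pos S) ≡ restr W' (M.map f m0)
map-sub-pos≡restr S f W' h nothing = refl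
map-sub-pos≡restr S f W' h (just p) rewrite h p with lookup S p in eq
... | true = trans (cong (M.map (λ i → f (sub S i))) (pos-just S p eq))
                   (cong (λ z → just (f z)) (proj₂ (sub-onto S p eq)))
... | false = cong (M.map _) (pos-out S p eq)

induced-all : ∀ F (S : Vec Bool (size F)) → (∀ v → lookup S v ≡ true) → F ≅ induced F S
induced-all F S h = InducedCharacterisation.iso F S F (λ v → v) (λ e → e) h (λ v _ → v , refl)
  (λ x → trans (map-id' (λ z → z) (λ _ → refl) (parent F x)) (aux (parent F x)))
  (λ _ _ → refl)
  where
  aux : ∀ m0 → m0 ≡ restr S m0
  aux nothing = refl
  aux (just p) rewrite h p = refl

transport : ∀ {F G} → F ≅ G → Vec Bool (size F) → Vec Bool (size G)
transport φ S = tabulate λ w → lookup S (_≅_.from φ w)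

transport-to : ∀ {F G} (φ : F ≅ G) S v → lookup (transport φ S) (_≅_.to φ v) ≡ lookup S v
transport-to φ S v = trans (lookup∘tabulate (λ w → lookup S (_≅_.from φ w)) (_≅_.to φ v)) (cong (lookup S) (_≅_.from∘to φ v))

induced-iso : ∀ {F G} (φ : F ≅ G) S → induced F S ≅ induced G (transport φ S)
induced-iso {F} {G} φ S = InducedCharacterisation.iso G (transport φ S) (induced F S) (λ i → to (sub S i))
  (λ e → sub-inj S (trans (sym (from∘to _)) (trans (cong from e) (from∘to _))))
  (λ i → trans (transport-to φ S (sub S i)) (sub-in S i))
  (λ w t → let i , ei = sub-onto S (from w) (trans (sym (lookup∘tabulate (λ w → lookup S (from w)) w)) t)
           in i , trans (cong to ei) (to∘from w))
  (λ i → trans (map-sub-pos≡restr S to (transport φ S) (transport-to φ S) (parent F (sub S i)))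
               (cong (restr (transport φ S)) (sym (parent-pres (sub S i)))))
  (λ i j → sym (le-pres (sub S i) (sub S j)))
  where open _≅_ φ

lookupMaybe : ∀ {k} → Vec Bool k → Maybe (Fin k) → Bool
lookupMaybe T nothing = false
lookupMaybe T (just i) = lookup T i

spread : ∀ {n} (S : Vec Bool n) → Vec Bool (count S) → Vec Bool n
spread S T = tabulate λ v → lookupMaybe T (pos S v)

spread-sub : ∀ {n} (S : Vec Bool n) T i → lookup (spread S T) (sub S i) ≡ lookup T i
spread-sub S T i = trans (lookup∘tabulate (λ v → lookupMaybe T (pos S v)) (sub S i)) (cong (lookupMaybe T) (pos-sub S i))

spread-out : ∀ {n} (S : Vec Bool n) T v → lookup S v ≡ false → lookup (spread S T) v ≡ false
spread-out S T v f = trans (lookup∘tabulate (λ v → lookupMaybe T (pos S v)) v) (cong (lookupMaybe T) (pos-out S v f))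

induced-induced : ∀ F S T → induced (induced F S) T ≅ induced F (spread S T)
induced-induced F S T = InducedCharacterisation.iso F (spread S T) (induced (induced F S) T)
  (λ k → sub S (sub T k))
  (λ e → sub-inj T (sub-inj S e))
  (λ k → trans (spread-sub S T (sub T k)) (sub-in T k))
  onto
  (λ k → aux (parent F (sub S (sub T k))))
  (λ _ _ → refl)
  where
  onto : ∀ v → lookup (spread S T) v ≡ true → Σ _ λ k → sub S (sub T k) ≡ v
  onto v t with lookup S v in eq
  ... | false = ⊥-elim (true≢false (trans (sym t) (spread-out S T v eq)))
  ... | true = let i , ei = sub-onto S v eq
                   k , ek = sub-onto T i (trans (sym (spread-sub S T i)) (trans (cong (lookup (spread S T)) ei) t))
               in k , trans (cong (sub S) ek) ei
  aux : ∀ m0 → M.map (λ k → sub S (sub T k)) ((m0 >>= pos S) >>= pos T) ≡ restr (spread S T) m0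
  aux nothing = refl
  aux (just p) with lookup S p in eq
  ... | false rewrite pos-out S p eq | spread-out S T p eq = refl
  ... | true rewrite pos-just S p eq =
    trans (map-sub-pos≡restr T (sub S) (spread S T) (spread-sub S T) (just (proj₁ (sub-onto S p eq))))
          (cong (λ z → restr (spread S T) (just z)) (proj₂ (sub-onto S p eq)))

heap-induced : ∀ F S → IsHeap F → IsHeap (induced F S)
heap-induced F S h a b a≢b r = h (sub S a) (sub S b) (λ e → a≢b (sub-inj S e)) (ind-path→ F S r)

induced-· : ∀ F G (S : Vec Bool (size F)) (S' : Vec Bool (size G)) →
  (induced F S · induced G S') ≅ induced (F · G) (S V.++ S')
induced-· F G S S' = InducedCharacterisation.iso (F · G) (S V.++ S') (A · B) e e-inj e-in e-onto e-par e-le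
  where
  A = induced F S
  B = induced G S'
  module PA = Prod A B
  module PF = Prod F G
  n = size F
  m = size G
  e : Fin (count S ℕ.+ count S') → Fin (n ℕ.+ m)
  e v with splitAt (count S) v
  ... | inj₁ i = sub S i ↑ˡ m
  ... | inj₂ j = n ↑ʳ sub S' j
  e-L : ∀ i → e (i ↑ˡ count S') ≡ sub S i ↑ˡ m
  e-L i rewrite splitAt-↑ˡ (count S) i (count S') = refl
  e-R : ∀ j → e (count S ↑ʳ j) ≡ n ↑ʳ sub S' j
  e-R j rewrite splitAt-↑ʳ (count S) (count S') j = refl
  e-inj : ∀ {x y} → e x ≡ e y → x ≡ y
  e-inj {x} {y} eq with PA.view x | PA.view y
  ... | PA.isL i | PA.isL i' = cong (_↑ˡ count S') (sub-inj S (↑ˡ-injective m _ _ (trans (sym (e-L i)) (trans eq (e-L i')))))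
  ... | PA.isR j | PA.isR j' = cong (count S ↑ʳ_) (sub-inj S' (↑ʳ-injective n _ _ (trans (sym (e-R j)) (trans eq (e-R j')))))
  ... | PA.isL i | PA.isR j = ⊥-elim (PF.L≢R _ _ (trans (sym (e-L i)) (trans eq (e-R j))))
  ... | PA.isR j | PA.isL i = ⊥-elim (PF.L≢R _ _ (sym (trans (sym (e-R j)) (trans eq (e-L i)))))
  e-in : ∀ x → lookup (S V.++ S') (e x) ≡ true
  e-in x with PA.view x
  ... | PA.isL i = trans (cong (lookup (S V.++ S')) (e-L i)) (trans (lookup-++ˡ S S' _) (sub-in S i))
  ... | PA.isR j = trans (cong (lookup (S V.++ S')) (e-R j)) (trans (lookup-++ʳ S S' _) (sub-in S' j))
  e-onto : ∀ v → lookup (S V.++ S') v ≡ true → Σ _ λ x → e x ≡ v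
  e-onto v t with PF.view v
  ... | PF.isL a = let i , ei = sub-onto S a (trans (sym (lookup-++ˡ S S' a)) t)
                   in i ↑ˡ count S' , trans (e-L i) (cong (_↑ˡ m) ei)
  ... | PF.isR b = let j , ej = sub-onto S' b (trans (sym (lookup-++ʳ S S' b)) t)
                   in count S ↑ʳ j , trans (e-R j) (cong (n ↑ʳ_) ej)
  e-par : ∀ x → M.map e (parent (A · B) x) ≡ restr (S V.++ S') (parent (F · G) (e x))
  e-par x with PA.view x
  ... | PA.isL i =
    trans (cong (M.map e) (PA.par-L i))
    (trans (map-∘ e _ (parent A i))
    (trans (map-cong e-L (parent A i))
    (trans (map-sub-pos≡restr S (_↑ˡ m) (S V.++ S') (lookup-++ˡ S S') (parent F (sub S i)))
           (cong (restr (S V.++ S')) (sym (trans (cong (parent (F · G)) (e-L i)) (PF.par-L (sub S i))))))))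
  ... | PA.isR j =
    trans (cong (M.map e) (PA.par-R j))
    (trans (map-∘ e _ (parent B j))
    (trans (map-cong e-R (parent B j))
    (trans (map-sub-pos≡restr S' (n ↑ʳ_) (S V.++ S') (lookup-++ʳ S S') (parent G (sub S' j)))
           (cong (restr (S V.++ S')) (sym (trans (cong (parent (F · G)) (e-R j)) (PF.par-R (sub S' j))))))))
  e-le : ∀ x y → le (A · B) x y ≡ le (F · G) (e x) (e y)
  e-le x y with PA.view x | PA.view y
  ... | PA.isL i | PA.isL i' = trans (PA.le-LL i i') (sym (trans (P.cong₂ (le (F · G)) (e-L i) (e-L i')) (PF.le-LL _ _)))
  ... | PA.isR j | PA.isR j' = trans (PA.le-RR j j') (sym (trans (P.cong₂ (le (F · G)) (e-R j) (e-R j')) (PF.le-RR _ _)))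
  ... | PA.isL i | PA.isR j = trans (PA.le-LR i j) (sym (trans (P.cong₂ (le (F · G)) (e-L i) (e-R j)) (PF.le-LR _ _)))
  ... | PA.isR j | PA.isL i = trans (PA.le-RL i j) (sym (trans (P.cong₂ (le (F · G)) (e-R j) (e-L i)) (PF.le-RL _ _)))

restrict : ∀ {n} (S : Vec Bool n) → Vec Bool n → Vec Bool (count S)
restrict S X = tabulate λ i → lookup X (sub S i)

union : ∀ {n} → Vec Bool n → Vec Bool n → Vec Bool n
union X Y = V.zipWith _∨_ X Y

∁ : ∀ {n} → Vec Bool n → Vec Bool n
∁ S = V.map not S

diff : ∀ {n} → Vec Bool n → Vec Bool n → Vec Bool n
diff X Y = tabulate λ v → lookup X v ∧ not (lookup Y v)

lookup-restrict : ∀ {n} (S X : Vec Bool n) i → lookup (restrict S X) i ≡ lookup X (sub S i)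
lookup-restrict S X i = lookup∘tabulate (λ i → lookup X (sub S i)) i

lookup-union : ∀ {n} (X Y : Vec Bool n) v → lookup (union X Y) v ≡ (lookup X v ∨ lookup Y v)
lookup-union X Y v = lookup-zipWith _∨_ v X Y

lookup-∁ : ∀ {n} (S : Vec Bool n) v → lookup (∁ S) v ≡ not (lookup S v)
lookup-∁ S v = lookup-map v not S

lookup-diff : ∀ {n} (X Y : Vec Bool n) v → lookup (diff X Y) v ≡ (lookup X v ∧ not (lookup Y v))
lookup-diff X Y v = lookup∘tabulate (λ v → lookup X v ∧ not (lookup Y v)) v

not≡true⇒≡false : ∀ {b} → not b ≡ true → b ≡ false
not≡true⇒≡false {false} _ = refl
not≡false⇒≡true : ∀ {b} → not b ≡ false → b ≡ true
not≡false⇒≡true {true} _ = refl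

spread-case : ∀ {n} (S : Vec Bool n) T v →
  (Σ (Fin (count S)) λ i → sub S i ≡ v × lookup (spread S T) v ≡ lookup T i) ⊎
  (lookup S v ≡ false × lookup (spread S T) v ≡ false)
spread-case S T v with lookup S v in eq
... | true = let i , ei = sub-onto S v eq in inj₁ (i , ei , trans (cong (lookup (spread S T)) (sym ei)) (spread-sub S T i))
... | false = inj₂ (refl , spread-out S T v eq)

restrict-spread : ∀ {n} (S : Vec Bool n) T → restrict S (spread S T) ≡ T
restrict-spread S T = lookup-ext λ i → trans (lookup-restrict S (spread S T) i) (spread-sub S T i)

spread-inj : ∀ {n} (S : Vec Bool n) {T T'} → spread S T ≡ spread S T' → T ≡ T'
spread-inj S {T} {T'} e = trans (sym (restrict-spread S T)) (trans (cong (restrict S) e) (restrict-spread S T'))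

spread-sub⊆ : ∀ {n} (S : Vec Bool n) T v → lookup (spread S T) v ≡ true → lookup S v ≡ true
spread-sub⊆ S T v t with spread-case S T v
... | inj₁ (i , refl , _) = sub-in S i
... | inj₂ (_ , f) = ⊥-elim (true≢false (trans (sym t) f))

spread-restrict : ∀ {n} (S X : Vec Bool n) → (∀ v → lookup X v ≡ true → lookup S v ≡ true) →
                  spread S (restrict S X) ≡ X
spread-restrict S X sub⊆ = lookup-ext λ v → pointwise v
  where
  pointwise : ∀ v → lookup (spread S (restrict S X)) v ≡ lookup X v
  pointwise v with spread-case S (restrict S X) v
  ... | inj₁ (i , refl , e) = trans e (lookup-restrict S X i)
  ... | inj₂ (f , e) with lookup X v in eq
  ... | false = e
  ... | true = ⊥-elim (true≢false (trans (sym (sub⊆ v eq)) f))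

union-restrict : ∀ {n} (S1 S2 : Vec Bool n) → (∀ v → lookup S1 v ≡ true → lookup S2 v ≡ true) →
                 union S1 (spread (∁ S1) (restrict (∁ S1) S2)) ≡ S2
union-restrict S1 S2 sub⊆ = lookup-ext λ v → trans (lookup-union S1 _ v) (pointwise v)
  where
  pointwise : ∀ v → (lookup S1 v ∨ lookup (spread (∁ S1) (restrict (∁ S1) S2)) v) ≡ lookup S2 v
  pointwise v with lookup S1 v in eq
  ... | true = sym (sub⊆ v eq)
  ... | false with spread-case (∁ S1) (restrict (∁ S1) S2) v
  ... | inj₁ (i , refl , e) = trans e (lookup-restrict (∁ S1) S2 i)
  ... | inj₂ (f , _) = ⊥-elim (true≢false (trans (sym (trans (lookup-∁ S1 v) (cong not eq))) f))

restrict-union : ∀ {n} (S1 : Vec Bool n) U → restrict (∁ S1) (union S1 (spread (∁ S1) U)) ≡ U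
restrict-union S1 U = lookup-ext λ i → trans (lookup-restrict (∁ S1) (union S1 (spread (∁ S1) U)) i)
  (trans (lookup-union S1 (spread (∁ S1) U) (sub (∁ S1) i))
  (trans (cong (_∨ lookup (spread (∁ S1) U) (sub (∁ S1) i))
                (not≡true⇒≡false (trans (sym (lookup-∁ S1 (sub (∁ S1) i))) (sub-in (∁ S1) i))))
         (spread-sub (∁ S1) U i)))

spread-∁≡diff : ∀ {n} (S1 S2 : Vec Bool n) T → S1 ≡ spread S2 T → spread S2 (∁ T) ≡ diff S2 S1
spread-∁≡diff S1 S2 T refl = lookup-ext λ v → trans (pointwise v) (sym (lookup-diff S2 (spread S2 T) v))
  where
  pointwise : ∀ v → lookup (spread S2 (∁ T)) v ≡ (lookup S2 v ∧ not (lookup (spread S2 T) v))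
  pointwise v with spread-case S2 (∁ T) v
  ... | inj₁ (i , refl , e) rewrite sub-in S2 i | spread-sub S2 T i = trans e (lookup-∁ T i)
  ... | inj₂ (f , e) rewrite f = e

spread-union≡diff : ∀ {n} (S1 S2 : Vec Bool n) U → S2 ≡ union S1 (spread (∁ S1) U) → spread (∁ S1) U ≡ diff S2 S1
spread-union≡diff S1 S2 U refl = lookup-ext λ v → trans (pointwise v) (sym (lookup-diff (union S1 (spread (∁ S1) U)) S1 v))
  where
  pointwise : ∀ v → lookup (spread (∁ S1) U) v ≡ (lookup (union S1 (spread (∁ S1) U)) v ∧ not (lookup S1 v))
  pointwise v rewrite lookup-union S1 (spread (∁ S1) U) v with spread-case (∁ S1) U v
  ... | inj₁ (j , refl , e) rewrite not≡true⇒≡false (trans (sym (lookup-∁ S1 (sub (∁ S1) j))) (sub-in (∁ S1) j)) | e =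
    sym (∧-identityʳ _)
  ... | inj₂ (f , e) rewrite not≡false⇒≡true (trans (sym (lookup-∁ S1 v)) f) | e = refl

spread-∁≡∁-union : ∀ {n} (S1 S2 : Vec Bool n) U → S2 ≡ union S1 (spread (∁ S1) U) → spread (∁ S1) (∁ U) ≡ ∁ S2
spread-∁≡∁-union S1 S2 U refl = lookup-ext λ v → trans (pointwise v) (sym (lookup-∁ (union S1 (spread (∁ S1) U)) v))
  where
  pointwise : ∀ v → lookup (spread (∁ S1) (∁ U)) v ≡ not (lookup (union S1 (spread (∁ S1) U)) v)
  pointwise v rewrite lookup-union S1 (spread (∁ S1) U) v with spread-case (∁ S1) (∁ U) v
  ... | inj₁ (j , refl , e) rewrite not≡true⇒≡false (trans (sym (lookup-∁ S1 (sub (∁ S1) j))) (sub-in (∁ S1) j))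
                                  | spread-sub (∁ S1) U j = trans e (lookup-∁ U j)
  ... | inj₂ (f , e) rewrite not≡false⇒≡true (trans (sym (lookup-∁ S1 v)) f) = e

module ClosedOps (F : PForest) where
  open Cl using (Closed)
  _⇝_ = _↠_ F

  closed-spread : ∀ S2 T → Closed F S2 → Closed (induced F S2) T → Closed F (spread S2 T)
  closed-spread S2 T c2 cT u v r t with spread-case S2 T v
  ... | inj₂ (_ , f) = ⊥-elim (true≢false (trans (sym t) f))
  ... | inj₁ (j , refl , e) =
    let ui = c2 u (sub S2 j) r (sub-in S2 j)
        i , ei = sub-onto S2 u ui
        rI = ind-path← F S2 r (λ w _ wv → c2 w (sub S2 j) wv (sub-in S2 j)) i j ei refl
    in trans (cong (lookup (spread S2 T)) (sym ei))
             (trans (spread-sub S2 T i) (cT i j rI (trans (sym e) t)))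

  closed-restrict : ∀ S X → Closed F X → Closed (induced F S) (restrict S X)
  closed-restrict S X c i j r t =
    trans (lookup-restrict S X i) (c _ _ (ind-path→ F S r) (trans (sym (lookup-restrict S X j)) t))

  ∁-rootward-closed : ∀ S1 → Closed F S1 → ∀ u → lookup S1 u ≡ false → ∀ w → u ⇝ w → lookup (∁ S1) w ≡ true
  ∁-rootward-closed S1 c1 u equ w uw with lookup S1 w in eqw
  ... | true = ⊥-elim (true≢false (trans (sym (c1 u w uw eqw)) equ))
  ... | false = trans (lookup-∁ S1 w) (cong not eqw)

  closed-union : ∀ S1 U → Closed F S1 → Closed (induced F (∁ S1)) U →
                 Closed F (union S1 (spread (∁ S1) U))
  closed-union S1 U c1 cU u v r t with lookup S1 u in equ
  ... | true = trans (lookup-union S1 (spread (∁ S1) U) u) (cong (_∨ lookup (spread (∁ S1) U) u) equ)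
  ... | false with lookup S1 v in eqv
  ... | true = ⊥-elim (true≢false (trans (sym (c1 u v r eqv)) equ))
  ... | false with spread-case (∁ S1) U v
  ... | inj₂ (f , _) = ⊥-elim (true≢false (trans (sym (trans (lookup-∁ S1 v) (cong not eqv))) f))
  ... | inj₁ (j , refl , e) =
    let ui = trans (lookup-∁ S1 u) (cong not equ)
        i , ei = sub-onto (∁ S1) u ui
        rI = ind-path← F (∁ S1) r (λ w uw _ → ∁-rootward-closed S1 c1 u equ w uw) i j ei refl
        Uj : lookup U j ≡ true
        Uj = trans (sym e) (trans (sym (cong (_∨ lookup (spread (∁ S1) U) (sub (∁ S1) j)) eqv))
              (trans (sym (lookup-union S1 (spread (∁ S1) U) _)) t))
    in trans (lookup-union S1 (spread (∁ S1) U) u) (trans (cong (_∨ lookup (spread (∁ S1) U) u) equ)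
             (trans (cong (lookup (spread (∁ S1) U)) (sym ei))
                    (trans (spread-sub (∁ S1) U i) (cU i j rI Uj))))

≡⇒≅ : ∀ {F G} → F ≡ G → F ≅ G
≡⇒≅ refl = ≅-refl

transport-inj : ∀ {F G} (φ : F ≅ G) {S S'} → transport φ S ≡ transport φ S' → S ≡ S'
transport-inj φ {S} {S'} e = lookup-ext λ v →
  P.trans (P.sym (transport-to φ S v)) (P.trans (cong (λ X → lookup X (_≅_.to φ v)) e) (transport-to φ S' v))

transport-back : ∀ {F G} (φ : F ≅ G) S' → transport φ (transport (≅-sym φ) S') ≡ S'
transport-back φ S' = lookup-ext λ w →
  P.trans (lookup∘tabulate (λ w → lookup (transport (≅-sym φ) S') (_≅_.from φ w)) w)
  (P.trans (lookup∘tabulate (λ v → lookup S' (_≅_.to φ v)) (_≅_.from φ w)) (cong (lookup S') (_≅_.to∘from φ w)))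

transport-∁ : ∀ {F G} (φ : F ≅ G) S → transport φ (∁ S) ≡ ∁ (transport φ S)
transport-∁ φ S = lookup-ext λ w →
  P.trans (lookup∘tabulate (λ w → lookup (∁ S) (_≅_.from φ w)) w)
  (P.trans (lookup-∁ S _) (P.sym (P.trans (lookup-∁ (transport φ S) w)
        (cong not (lookup∘tabulate (λ w → lookup S (_≅_.from φ w)) w)))))

closed-transport : ∀ {F G} (φ : F ≅ G) S → Cl.Closed F S → Cl.Closed G (transport φ S)
closed-transport {F} {G} φ S c u v r t =
  P.trans (lookup∘tabulate (λ w → lookup S (_≅_.from φ w)) u)
    (c _ _ (iso-path (≅-sym φ) r) (P.trans (P.sym (lookup∘tabulate (λ w → lookup S (_≅_.from φ w)) v)) t))

∅ : ∀ n → Vec Bool n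
∅ n = V.replicate n false
full : ∀ n → Vec Bool n
full n = V.replicate n true

count-∅ : ∀ n → count (∅ n) ≡ 0
count-∅ zero = refl
count-∅ (suc n) = count-∅ n

count-nonzero : ∀ {n} (S : Vec Bool n) v → lookup S v ≡ true → Σ ℕ λ k → count S ≡ suc k
count-nonzero (true ∷ S) Fin.zero _ = count S , refl
count-nonzero (false ∷ S) Fin.zero ()
count-nonzero (true ∷ S) (Fin.suc v) _ = count S , refl
count-nonzero (false ∷ S) (Fin.suc v) e = count-nonzero S v e

∅-or-member : ∀ {n} (S : Vec Bool n) → S ≡ ∅ n ⊎ Σ (Fin n) λ v → lookup S v ≡ true
∅-or-member [] = inj₁ refl
∅-or-member (true ∷ S) = inj₂ (Fin.zero , refl)
∅-or-member (false ∷ S) with ∅-or-member S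
... | inj₁ e = inj₁ (cong (false ∷_) e)
... | inj₂ (v , e) = inj₂ (Fin.suc v , e)

∁-full : ∀ n → ∁ (full n) ≡ ∅ n
∁-full n = map-replicate not true n

lookup-∁-∅ : ∀ n v → lookup (∁ (∅ n)) v ≡ true
lookup-∁-∅ n v = P.trans (lookup-∁ (∅ n) v) (cong not (lookup-replicate v false))

∁-nonempty : ∀ {n} (S : Vec Bool n) → S ≢ full n → Σ (Fin n) λ v → lookup (∁ S) v ≡ true
∁-nonempty {n} S ne with ∅-or-member (∁ S)
... | inj₂ r = r
... | inj₁ e = ⊥-elim (ne (P.trans (P.sym (∁-involutive S)) (P.trans (cong ∁ e) (map-replicate not false n))))
  where
  ∁-involutive : ∀ {n} (S : Vec Bool n) → ∁ (∁ S) ≡ S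
  ∁-involutive [] = refl
  ∁-involutive (x ∷ S) = P.cong₂ _∷_ (not-involutive x) (∁-involutive S)

+-suc≤⇒≤ : ∀ a b {n j} → a ℕ.+ suc b ≡ n → n ≤ suc j → a ≤ j
+-suc≤⇒≤ a b {n} {j} e le =
  NP.m+n≤o⇒m≤o a (NP.≤-pred (subst (_≤ suc j) (P.trans (P.sym e) (NP.+-suc a b)) le))

suc-+≤⇒≤ : ∀ a b {n j} → suc a ℕ.+ b ≡ n → n ≤ suc j → b ≤ j
suc-+≤⇒≤ a b {n} {j} e le = NP.m+n≤o⇒m≤o b (subst (_≤ j) (NP.+-comm a b) (NP.≤-pred (subst (_≤ suc j) (P.sym e) le)))

zero-or-suc : ∀ (n : ℕ) → n ≡ 0 ⊎ Σ ℕ λ m → n ≡ suc m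
zero-or-suc zero = inj₁ refl
zero-or-suc (suc m) = inj₂ (m , refl)

module _ {c ℓ} (K : CommutativeRing c ℓ) where
  open CommutativeRing K renaming (refl to ≈refl; sym to ≈sym; trans to ≈trans)
  open HPO K

  module _ {B : Set} {_∼_ : B → B → Set} where
    private
      _≋_ = Eqv _∼_

    ≡⇒≋ : ∀ {u v} → u ≡ v → u ≋ v
    ≡⇒≋ refl = ≋-refl

    ≋-cons : ∀ x {u v} → u ≋ v → (x ∷ u) ≋ (x ∷ v)
    ≋-cons x p = ≋-++ {u = [ x ]} ≋-refl p

    ≋-++ˡ : ∀ u {v v'} → v ≋ v' → (u ++ v) ≋ (u ++ v')
    ≋-++ˡ u p = ≋-++ (≋-refl {u = u}) p

    ≋-++ʳ : ∀ {u u'} v → u ≋ u' → (u ++ v) ≋ (u' ++ v)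
    ≋-++ʳ v p = ≋-++ p (≋-refl {u = v})

    ≋-move : ∀ u x v → (u ++ x ∷ v) ≋ (x ∷ u ++ v)
    ≋-move [] x v = ≋-refl
    ≋-move (y ∷ u) x v =
      ≋-trans (≋-cons y (≋-move u x v))
              (≋-++ {u = y ∷ x ∷ []} {u' = x ∷ y ∷ []} (≋-swap y x) ≋-refl)

    ≋-comm : ∀ u v → (u ++ v) ≋ (v ++ u)
    ≋-comm [] v = ≡⇒≋ (P.sym (LP.++-identityʳ v))
    ≋-comm (x ∷ u) v = ≋-trans (≋-cons x (≋-comm u v)) (≋-sym (≋-move v x u))

    ≋-assoc : ∀ u v w → ((u ++ v) ++ w) ≋ (u ++ (v ++ w))
    ≋-assoc u v w = ≡⇒≋ (LP.++-assoc u v w)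

    ≋-mid : ∀ u v w x → ((u ++ v) ++ (w ++ x)) ≋ ((u ++ w) ++ (v ++ x))
    ≋-mid u v w x =
      ≋-trans (≋-assoc u v (w ++ x))
      (≋-trans (≋-++ˡ u (≋-trans (≋-sym (≋-assoc v w x)) (≋-++ʳ x (≋-comm v w))))
      (≋-trans (≋-++ˡ u (≋-assoc w v x)) (≋-sym (≋-assoc u w (v ++ x)))))

    ≋-zeros : ∀ {u} → All (λ t → proj₁ t ≈ 0#) u → u ≋ []
    ≋-zeros [] = ≋-refl
    ≋-zeros {(a , b) ∷ u} (p ∷ ps) =
      ≋-trans (≋-++ (≋-trans (≋-coef b p) (≋-zero b)) (≋-zeros ps)) ≋-refl

    scale-++ : ∀ a (u v : Lin B) → scale a (u ++ v) ≡ scale a u ++ scale a v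
    scale-++ a [] v = refl
    scale-++ a (x ∷ u) v = cong (_ ∷_) (scale-++ a u v)

    scale-cong : ∀ a {u v} → u ≋ v → scale a u ≋ scale a v
    scale-cong a ≋-refl = ≋-refl
    scale-cong a (≋-sym p) = ≋-sym (scale-cong a p)
    scale-cong a (≋-trans p q) = ≋-trans (scale-cong a p) (scale-cong a q)
    scale-cong a (≋-++ {u} {u'} {v} {v'} p q) =
      ≋-trans (≡⇒≋ (scale-++ a u v))
      (≋-trans (≋-++ (scale-cong a p) (scale-cong a q)) (≡⇒≋ (P.sym (scale-++ a u' v'))))
    scale-cong a (≋-swap x y) = ≋-swap _ _
    scale-cong a (≋-merge x y b) =
      ≋-trans (≋-merge _ _ b) (≋-coef b (≈sym (distribˡ a x y)))
    scale-cong a (≋-zero b) = ≋-trans (≋-coef b (zeroʳ a)) (≋-zero b)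
    scale-cong a (≋-coef b e) = ≋-coef b (*-cong ≈refl e)
    scale-cong a (≋-basis x e) = ≋-basis _ e

    scale-coef : ∀ {a a'} u → a ≈ a' → scale a u ≋ scale a' u
    scale-coef [] e = ≋-refl
    scale-coef ((x , b) ∷ u) e = ≋-++ (≋-coef b (*-cong e ≈refl)) (scale-coef u e)

    scale-add : ∀ a a' u → (scale a u ++ scale a' u) ≋ scale (a + a') u
    scale-add a a' [] = ≋-refl
    scale-add a a' ((x , b) ∷ u) =
      ≋-trans (≋-cons _ (≋-move (scale a u) _ (scale a' u)))
      (≋-trans (≋-++ {u = _ ∷ _ ∷ []} (≋-trans (≋-merge _ _ b) (≋-coef b (≈sym (distribʳ x a a'))))
                     (scale-add a a' u)) ≋-refl)

    scale-0 : ∀ u → scale 0# u ≋ []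
    scale-0 [] = ≋-refl
    scale-0 ((x , b) ∷ u) =
      ≋-trans (≋-++ (≋-trans (≋-coef b (zeroˡ x)) (≋-zero b)) (scale-0 u)) ≋-refl

    scale-1 : ∀ u → scale 1# u ≋ u
    scale-1 [] = ≋-refl
    scale-1 ((x , b) ∷ u) = ≋-++ (≋-coef b (*-identityˡ x)) (scale-1 u)

    scale-scale : ∀ a a' u → scale a (scale a' u) ≋ scale (a * a') u
    scale-scale a a' [] = ≋-refl
    scale-scale a a' ((x , b) ∷ u) = ≋-++ (≋-coef b (≈sym (*-assoc a a' x))) (scale-scale a a' u)

  module _ {B C : Set} where
    bind-++ : ∀ (f : B → Lin C) u v → bind f (u ++ v) ≡ bind f u ++ bind f v
    bind-++ f [] v = refl
    bind-++ f ((a , b) ∷ u) v =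
      P.trans (cong (scale a (f b) ++_) (bind-++ f u v)) (P.sym (LP.++-assoc (scale a (f b)) _ _))

  module _ {B C : Set} {_∼'_ : C → C → Set} where
    private
      _≋'_ = Eqv _∼'_

    bind-scale : ∀ (f : B → Lin C) a u → bind f (scale a u) ≋' scale a (bind f u)
    bind-scale f a [] = ≋-refl
    bind-scale f a ((x , b) ∷ u) =
      ≋-trans (≋-++ (≋-sym (scale-scale {_∼_ = _∼'_} a x (f b))) (bind-scale f a u))
              (≡⇒≋ (P.sym (scale-++ {_∼_ = _∼'_} a (scale x (f b)) (bind f u))))

  module _ {B C : Set} {_∼_ : B → B → Set} {_∼'_ : C → C → Set} where
    private
      _≋_ = Eqv _∼_
      _≋'_ = Eqv _∼'_

    bind-cong : (f : B → Lin C) → (∀ {b b'} → b ∼ b' → f b ≋' f b') →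
                ∀ {u v} → u ≋ v → bind f u ≋' bind f v
    bind-cong f fc ≋-refl = ≋-refl
    bind-cong f fc (≋-sym p) = ≋-sym (bind-cong f fc p)
    bind-cong f fc (≋-trans p q) = ≋-trans (bind-cong f fc p) (bind-cong f fc q)
    bind-cong f fc (≋-++ {u} {u'} {v} {v'} p q) =
      ≋-trans (≡⇒≋ (bind-++ f u v))
      (≋-trans (≋-++ (bind-cong f fc p) (bind-cong f fc q)) (≡⇒≋ (P.sym (bind-++ f u' v'))))
    bind-cong f fc (≋-swap (a , b) (a' , b')) =
      ≋-trans (≋-++ˡ (scale a (f b)) (≡⇒≋ (LP.++-identityʳ _)))
      (≋-trans (≋-comm (scale a (f b)) (scale a' (f b')))
               (≋-++ˡ (scale a' (f b')) (≡⇒≋ (P.sym (LP.++-identityʳ _)))))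
    bind-cong f fc (≋-merge a a' b) =
      ≋-trans (≋-++ˡ (scale a (f b)) (≡⇒≋ (LP.++-identityʳ _)))
              (≋-trans (scale-add a a' (f b)) (≡⇒≋ (P.sym (LP.++-identityʳ _))))
    bind-cong f fc (≋-zero b) = ≋-++ʳ [] (scale-0 (f b))
    bind-cong f fc (≋-coef b e) = ≋-++ʳ [] (scale-coef (f b) e)
    bind-cong f fc (≋-basis a e) = ≋-++ʳ [] (scale-cong a (fc e))

  module _ {B C : Set} {_∼'_ : C → C → Set} where
    private
      _≋'_ = Eqv _∼'_

    bind-ext : (f g : B → Lin C) → (∀ b → f b ≋' g b) → ∀ u → bind f u ≋' bind g u
    bind-ext f g e [] = ≋-refl
    bind-ext f g e ((a , b) ∷ u) = ≋-++ (scale-cong a (e b)) (bind-ext f g e u)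

    bind-basis : (f : B → Lin C) → ∀ b → bind f [ (1# , b) ] ≋' f b
    bind-basis f b = ≋-trans (≡⇒≋ (LP.++-identityʳ _)) (scale-1 (f b))

  module _ {B C D : Set} {_∼_ : D → D → Set} where
    bind-bind : ∀ (f : B → Lin C) (g : C → Lin D) u →
                Eqv _∼_ (bind g (bind f u)) (bind (λ b → bind g (f b)) u)
    bind-bind f g [] = ≋-refl
    bind-bind f g ((a , b) ∷ u) =
      ≋-trans (≡⇒≋ (bind-++ g (scale a (f b)) (bind f u)))
              (≋-++ (bind-scale g a (f b)) (bind-bind f g u))

  module _ {B : Set} {_∼_ : B → B → Set} where
    private
      _≋_ = Eqv _∼_

    concatMap-cong : ∀ {X : Set} (f g : X → Lin B) xs → (∀ {x} → x ∈ xs → f x ≋ g x) → concatMap f xs ≋ concatMap g xs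
    concatMap-cong f g [] e = ≋-refl
    concatMap-cong f g (x ∷ xs) e = ≋-++ (e (here refl)) (concatMap-cong f g xs (λ m → e (there m)))

    concatMap-≋[] : ∀ {X : Set} (f : X → Lin B) xs → (∀ {x} → x ∈ xs → f x ≋ []) → concatMap f xs ≋ []
    concatMap-≋[] f [] e = ≋-refl
    concatMap-≋[] f (x ∷ xs) e = ≋-++ (e (here refl)) (concatMap-≋[] f xs (λ m → e (there m)))

    concatMap-single : ∀ {X : Set} (f : X → Lin B) xs x₀ → Unique xs → x₀ ∈ xs →
                  (∀ {x} → x ∈ xs → x ≢ x₀ → f x ≋ []) → concatMap f xs ≋ f x₀
    concatMap-single f xs x₀ u m e with ∈-∃++ m
    ... | as , cs , refl =
      let u' , q = Unique-delete as u in
      ≋-trans (≡⇒≋ (LP.concatMap-++ f as (x₀ ∷ cs)))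
      (≋-trans (≋-++ (concatMap-≋[] f as (λ {x} mx → e (∈-++⁺ˡ mx) (λ eq → All.lookup q (∈-++⁺ˡ mx) (P.sym eq))))
                     (≋-++ˡ (f x₀) (concatMap-≋[] f cs (λ {x} mx → e (∈-++⁺ʳ as (there mx))
                                 (λ eq → All.lookup q (∈-++⁺ʳ as mx) (P.sym eq))))))
               (≡⇒≋ (LP.++-identityʳ (f x₀))))

    concatMap-reindex : ∀ {X Z Y : Set} (f : X → Lin B) (g : Z → Lin B) (hx : X → Y) (hz : Z → Y) →
      ∀ xs zs → Unique (L.map hx xs) → Unique (L.map hz zs) →
      (∀ {x} → x ∈ xs → ∃ λ z → z ∈ zs × hz z ≡ hx x) →
      (∀ {z} → z ∈ zs → ∃ λ x → x ∈ xs × hx x ≡ hz z) →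
      (∀ {x z} → x ∈ xs → z ∈ zs → hx x ≡ hz z → f x ≋ g z) →
      concatMap f xs ≋ concatMap g zs
    concatMap-reindex f g hx hz [] [] ux uz xz zx fg = ≋-refl
    concatMap-reindex f g hx hz [] (z ∷ zs) ux uz xz zx fg with zx (here refl)
    ... | _ , () , _
    concatMap-reindex f g hx hz (x ∷ xs) zs (px ∷ ux) uz xz zx fg with xz (here refl)
    ... | z , mz , ez with ∈-∃++ mz
    ... | zs1 , zs2 , refl =
      let uz0 = subst Unique (LP.map-++ hz zs1 (z ∷ zs2)) uz
          uz' , q = Unique-delete (L.map hz zs1) uz0
          uz'' = subst Unique (P.sym (LP.map-++ hz zs1 zs2)) uz'
          rec = concatMap-reindex f g hx hz xs (zs1 ++ zs2) ux uz''
            (λ {x'} mx' → xzr x' mx')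
            (λ {z'} mz' → zxr z' mz')
            (λ mx mz e → fg (there mx) (∈-insert zs1 mz) e)
      in ≋-trans (≋-++ (fg (here refl) mz (P.sym ez)) rec)
         (≋-trans (≋-++ˡ (g z) (≡⇒≋ (LP.concatMap-++ g zs1 zs2)))
         (≋-trans (≋-sym (≋-assoc (g z) (concatMap g zs1) (concatMap g zs2)))
         (≋-trans (≋-++ʳ (concatMap g zs2) (≋-comm (g z) (concatMap g zs1)))
         (≋-trans (≋-assoc (concatMap g zs1) (g z) (concatMap g zs2))
                  (≡⇒≋ (P.sym (LP.concatMap-++ g zs1 (z ∷ zs2))))))))
      where
      xzr : ∀ x' → x' ∈ xs → ∃ λ z' → z' ∈ zs1 ++ zs2 × hz z' ≡ hx x'
      xzr x' mx' with xz (there mx')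
      ... | z' , mz' , e' with ∈-++⁻ zs1 mz'
      ... | inj₁ m1 = z' , ∈-++⁺ˡ m1 , e'
      ... | inj₂ (there m2) = z' , ∈-++⁺ʳ zs1 m2 , e'
      ... | inj₂ (here refl) =
        ⊥-elim (All.lookup px (∈-map⁺ hx mx') (P.trans (P.sym ez) e'))
      zxr : ∀ z' → z' ∈ zs1 ++ zs2 → ∃ λ x' → x' ∈ xs × hx x' ≡ hz z'
      zxr z' mz' with zx (∈-insert zs1 mz')
      ... | x' , there mx' , e' = x' , mx' , e'
      ... | x' , here refl , e' =
        let uz0 = subst Unique (LP.map-++ hz zs1 (z ∷ zs2)) uz
            _ , q = Unique-delete (L.map hz zs1) uz0
        in ⊥-elim (All.lookup q (subst (hz z' ∈_) (LP.map-++ hz zs1 zs2) (∈-map⁺ hz mz'))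
                      (P.trans ez e'))

  -- The bialgebra H_po

  closedSets-transport : ∀ {B : Set} {_∼_ : B → B → Set} {F G} (φ : F ≅ G)
    (g : Vec Bool (size F) → Lin B) (g' : Vec Bool (size G) → Lin B) →
    (∀ S → Cl.Closed F S → Eqv _∼_ (g S) (g' (transport φ S))) →
    Eqv _∼_ (concatMap g (Cl.closedSets F)) (concatMap g' (Cl.closedSets G))
  closedSets-transport {F = F} {G} φ g g' h = concatMap-reindex g g' (transport φ) (λ z → z) (Cl.closedSets F) (Cl.closedSets G)
    (UP.map⁺ (transport-inj φ) (Cl.closedSets-unique F))
    (subst Unique (P.sym (LP.map-id (Cl.closedSets G))) (Cl.closedSets-unique G))
    (λ {S} mS → transport φ S , Cl.∈closed G (closed-transport φ S (Cl.closed∈ F mS)) , refl)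
    (λ {S'} mS' → transport (≅-sym φ) S' ,
        Cl.∈closed F (closed-transport (≅-sym φ) S' (Cl.closed∈ G mS')) , transport-back φ S')
    (λ {S} mS _ e → ≋-trans (h S (Cl.closed∈ F mS)) (≡⇒≋ (cong g' e)))

  Δclosed-term : (F : PForest) → Vec Bool (size F) → H⊗H
  Δclosed-term F S = [ (1# , (induced F S , induced F (∁ S))) ]

  Δclosed : PForest → H⊗H
  Δclosed F = concatMap (Δclosed-term F) (Cl.closedSets F)

  cuts→closed : ∀ {B : Set} {_∼_ : B → B → Set} (F : PForest) (g : Vec Bool (size F) → Lin B) →
    Eqv _∼_ (concatMap (λ W → g (Cuts.leaSet F W)) (Cuts.admissibleCuts F)) (concatMap g (Cl.closedSets F))
  cuts→closed F g = concatMap-reindex (λ W → g (leaSet W)) g leaSet (λ z → z) admissibleCuts closedSets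
    (map⁺-injectiveOn leaSet admissibleCuts cuts-unique
      (λ {x} {y} mx my e → P.trans (P.sym (maxOf-leaSet x (cut∈ mx))) (P.trans (cong maxOf e) (maxOf-leaSet y (cut∈ my)))))
    (subst Unique (P.sym (LP.map-id closedSets)) closedSets-unique)
    (λ {W} mW → leaSet W , ∈closed (leaSet-closed W) , refl)
    (λ {S} mS → maxOf S , ∈cut (maxOf-admissible S (closed∈ mS)) , leaSet-maxOf S (closed∈ mS))
    (λ _ _ e → ≡⇒≋ (cong g e))
    where
    open Cl F
    open Cuts F using (leaSet; admissibleCuts)

  Δb≈Δclosed : ∀ F → Δb F ≈H₂ Δclosed F
  Δb≈Δclosed F = ≋-trans (≡⇒≋ (map≡concatMap _ (Cuts.admissibleCuts F))) (cuts→closed F (Δclosed-term F))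

  Δclosed-cong : ∀ {F G} → F ≅ G → Δclosed F ≈H₂ Δclosed G
  Δclosed-cong {F} {G} φ = closedSets-transport φ (Δclosed-term F) (Δclosed-term G) λ S _ →
    ≋-basis 1# (induced-iso φ S , ≅-trans (induced-iso φ (∁ S)) (≡⇒≅ (cong (induced G) (transport-∁ φ S))))

  Δb-cong : ∀ {F G} → F ≅ G → Δb F ≈H₂ Δb G
  Δb-cong {F} {G} φ = ≋-trans (Δb≈Δclosed F) (≋-trans (Δclosed-cong φ) (≋-sym (Δb≈Δclosed G)))

  bind-basis-id : ∀ {B : Set} {_∼_ : B → B → Set} (u : Lin B) → Eqv _∼_ (bind (λ b → [ (1# , b) ]) u) u
  bind-basis-id [] = ≋-refl
  bind-basis-id ((a , b) ∷ u) = ≋-++ (≋-coef b (*-identityʳ a)) (bind-basis-id u)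

  mul-cong : ∀ {u u' v v'} → u ≈H u' → v ≈H v' → mul u v ≈H mul u' v'
  mul-cong {u} {u'} {v} {v'} p q =
    ≋-trans (bind-cong (λ F → bind (λ G → basis (F · G)) v)
              (λ {F} {F'} φ → bind-ext _ _ (λ G → ≋-basis 1# (·-cong φ ≅-refl)) v) p)
            (bind-ext _ _ (λ F → bind-cong (λ G → basis (F · G)) (λ ψ → ≋-basis 1# (·-cong ≅-refl ψ)) q) u')

  Δ-cong : ∀ {u u'} → u ≈H u' → Δ u ≈H₂ Δ u'
  Δ-cong p = bind-cong Δb Δb-cong p

  εb-eq : ∀ F → εb F ≡ ifZero (size F) 1# 0#
  εb-eq F with size F
  ... | zero = refl
  ... | suc _ = refl

  εb-iso : ∀ {F G} → F ≅ G → εb F ≡ εb G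
  εb-iso {F} {G} φ = P.trans (εb-eq F) (P.trans (cong (λ n → ifZero n 1# 0#) (iso-size φ)) (P.sym (εb-eq G)))

  evalK-++ : ∀ {B : Set} (f : B → Carrier) u v → evalK f (u ++ v) ≈ evalK f u + evalK f v
  evalK-++ f [] v = ≈sym (+-identityˡ _)
  evalK-++ f ((a , b) ∷ u) v = ≈trans (+-cong ≈refl (evalK-++ f u v)) (≈sym (+-assoc _ _ _))

  evalK-cong : ∀ {B : Set} {_∼_ : B → B → Set} (f : B → Carrier) → (∀ {b b'} → b ∼ b' → f b ≈ f b') →
               ∀ {u v} → Eqv _∼_ u v → evalK f u ≈ evalK f v
  evalK-cong f fc ≋-refl = ≈refl
  evalK-cong f fc (≋-sym p) = ≈sym (evalK-cong f fc p)
  evalK-cong f fc (≋-trans p q) = ≈trans (evalK-cong f fc p) (evalK-cong f fc q)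
  evalK-cong f fc (≋-++ {u} {u'} {v} {v'} p q) =
    ≈trans (evalK-++ f u v) (≈trans (+-cong (evalK-cong f fc p) (evalK-cong f fc q)) (≈sym (evalK-++ f u' v')))
  evalK-cong f fc (≋-swap (a , b) (a' , b')) =
    ≈trans (≈sym (+-assoc _ _ _)) (≈trans (+-cong (+-comm _ _) ≈refl) (+-assoc _ _ _))
  evalK-cong f fc (≋-merge a a' b) =
    ≈trans (≈sym (+-assoc _ _ _)) (+-cong (≈sym (distribʳ (f b) a a')) ≈refl)
  evalK-cong f fc (≋-zero b) = ≈trans (+-identityʳ _) (zeroˡ _)
  evalK-cong f fc (≋-coef b e) = +-cong (*-cong e ≈refl) ≈refl
  evalK-cong f fc (≋-basis a e) = +-cong (*-cong ≈refl (fc e)) ≈refl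

  ε-cong : ∀ {u u'} → u ≈H u' → ε u ≈ ε u'
  ε-cong = evalK-cong εb (λ φ → reflexive (εb-iso φ))

  mul-assoc : ∀ u v w → mul (mul u v) w ≈H mul u (mul v w)
  mul-assoc u v w =
    ≋-trans (bind-bind (λ A → bind (λ B → basis (A · B)) v) h u)
    (≋-trans (bind-ext _ _ (λ A → ≋-trans (bind-bind (λ B → basis (A · B)) h v)
               (bind-ext _ _ (λ B → ≋-trans (bind-basis h (A · B))
                  (bind-ext _ _ (λ C → ≋-basis 1# (·-assoc A B C)) w)) v)) u)
    (≋-sym (bind-ext _ _ (λ A → ≋-trans (bind-bind (λ B → bind (λ C → basis (B · C)) w) (λ Y → basis (A · Y)) v)
               (bind-ext _ _ (λ B → ≋-trans (bind-bind (λ C → basis (B · C)) (λ Y → basis (A · Y)) w)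
                  (bind-ext _ _ (λ C → bind-basis (λ Y → basis (A · Y)) (B · C)) w)) v)) u)))
    where
    h : PForest → H
    h X = bind (λ G → basis (X · G)) w

  one-left : ∀ u → mul one u ≈H u
  one-left u = ≋-trans (bind-basis (λ F → bind (λ G → basis (F · G)) u) emptyF)
    (≋-trans (bind-ext _ _ (λ G → ≋-basis 1# (·-identityˡ G)) u) (bind-basis-id u))

  one-right : ∀ u → mul u one ≈H u
  one-right u = ≋-trans (bind-ext _ _ (λ F → ≋-trans (bind-basis (λ G → basis (F · G)) emptyF)
                   (≋-basis 1# (·-identityʳ F))) u) (bind-basis-id u)

  bind-concatMap-basis : ∀ {X B C : Set} {_∼_ : C → C → Set} (f : B → Lin C) (p : X → B) xs →
               Eqv _∼_ (bind f (concatMap (λ x → [ (1# , p x) ]) xs)) (concatMap (λ x → f (p x)) xs)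
  bind-concatMap-basis f p [] = ≋-refl
  bind-concatMap-basis f p (x ∷ xs) = ≋-++ (scale-1 (f (p x))) (bind-concatMap-basis f p xs)

  εb-size0 : ∀ F → size F ≡ 0 → εb F ≡ 1#
  εb-size0 F e = P.trans (εb-eq F) (cong (λ n → ifZero n 1# 0#) e)
  εb-size-suc : ∀ F {k} → size F ≡ suc k → εb F ≡ 0#
  εb-size-suc F e = P.trans (εb-eq F) (cong (λ n → ifZero n 1# 0#) e)

  ε⊗id-term : PForest × PForest → H
  ε⊗id-term (A , B) = [ (εb A , B) ]
  id⊗ε-term : PForest × PForest → H
  id⊗ε-term (A , B) = [ (εb B , A) ]

  ε⊗id-term-cong : ∀ {p q} → p ≅₂ q → ε⊗id-term p ≈H ε⊗id-term q
  ε⊗id-term-cong (φ , ψ) = ≋-trans (≋-coef _ (reflexive (εb-iso φ))) (≋-basis _ ψ)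
  id⊗ε-term-cong : ∀ {p q} → p ≅₂ q → id⊗ε-term p ≈H id⊗ε-term q
  id⊗ε-term-cong (φ , ψ) = ≋-trans (≋-coef _ (reflexive (εb-iso ψ))) (≋-basis _ φ)

  counit-left-basis : ∀ F → bind ε⊗id-term (Δb F) ≈H basis F
  counit-left-basis F =
    ≋-trans (bind-cong ε⊗id-term ε⊗id-term-cong (Δb≈Δclosed F))
    (≋-trans (bind-concatMap-basis ε⊗id-term (λ S → induced F S , induced F (∁ S)) (Cl.closedSets F))
    (≋-trans (concatMap-single _ (Cl.closedSets F) (∅ _) (Cl.closedSets-unique F)
                (Cl.∈closed F (λ u v r t → ⊥-elim (true≢false (P.trans (P.sym t) (lookup-replicate v false)))))
                nonExtremal)
    (≋-trans (≋-coef _ (reflexive (εb-size0 (induced F (∅ (size F))) (count-∅ (size F)))))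
             (≋-basis _ (≅-sym (induced-all F (∁ (∅ _)) (lookup-∁-∅ _)))))))
    where
    nonExtremal : ∀ {S} → S ∈ Cl.closedSets F → S ≢ ∅ _ → ε⊗id-term (induced F S , induced F (∁ S)) ≈H []
    nonExtremal {S} _ ne with ∅-or-member S
    ... | inj₁ e = ⊥-elim (ne e)
    ... | inj₂ (v , t) = ≋-trans (≋-coef _ (reflexive (εb-size-suc (induced F S) (proj₂ (count-nonzero S v t))))) (≋-zero _)

  counit-right-basis : ∀ F → bind id⊗ε-term (Δb F) ≈H basis F
  counit-right-basis F =
    ≋-trans (bind-cong id⊗ε-term id⊗ε-term-cong (Δb≈Δclosed F))
    (≋-trans (bind-concatMap-basis id⊗ε-term (λ S → induced F S , induced F (∁ S)) (Cl.closedSets F))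
    (≋-trans (concatMap-single _ (Cl.closedSets F) (full _) (Cl.closedSets-unique F)
                (Cl.∈closed F (λ u v r t → lookup-replicate u true))
                nonExtremal)
    (≋-trans (≋-coef _ (reflexive (εb-size0 (induced F (∁ (full (size F))))
          (P.trans (cong count (∁-full (size F))) (count-∅ (size F))))))
             (≋-basis _ (≅-sym (induced-all F (full _) (λ v → lookup-replicate v true)))))))
    where
    nonExtremal : ∀ {S} → S ∈ Cl.closedSets F → S ≢ full _ → id⊗ε-term (induced F S , induced F (∁ S)) ≈H []
    nonExtremal {S} _ ne = let v , t = ∁-nonempty S ne in
      ≋-trans (≋-coef _ (reflexive (εb-size-suc (induced F (∁ S)) (proj₂ (count-nonzero (∁ S) v t))))) (≋-zero _)

  counit-left : ∀ u → ε⊗id (Δ u) ≈H u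
  counit-left u = ≋-trans (bind-bind Δb ε⊗id-term u) (≋-trans (bind-ext _ _ counit-left-basis u) (bind-basis-id u))

  counit-right : ∀ u → id⊗ε (Δ u) ≈H u
  counit-right u = ≋-trans (bind-bind Δb id⊗ε-term u) (≋-trans (bind-ext _ _ counit-right-basis u) (bind-basis-id u))

  Δ-one : Δ one ≈H₂ one₂
  Δ-one = ≋-trans (bind-basis Δb emptyF)
        (≋-trans (Δb≈Δclosed emptyF) (≋-basis 1# (size≡0⇒≅ _ _ refl refl , size≡0⇒≅ _ _ refl refl)))

  ε-one : ε one ≈ 1#
  ε-one = ≈trans (+-identityʳ _) (*-identityˡ _)

  evalK-scale : ∀ {B : Set} (f : B → Carrier) a w → evalK f (scale a w) ≈ a * evalK f w
  evalK-scale f a [] = ≈sym (zeroʳ a)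
  evalK-scale f a ((x , b) ∷ w) =
    ≈trans (+-cong (*-assoc a x (f b)) (evalK-scale f a w)) (≈sym (distribˡ a _ _))

  evalK-bind : ∀ {B C : Set} (f : C → Carrier) (g : B → Lin C) u →
               evalK f (bind g u) ≈ evalK (λ b → evalK f (g b)) u
  evalK-bind f g [] = ≈refl
  evalK-bind f g ((a , b) ∷ u) =
    ≈trans (evalK-++ f (scale a (g b)) (bind g u)) (+-cong (evalK-scale f a (g b)) (evalK-bind f g u))

  evalK-ext : ∀ {B : Set} (f g : B → Carrier) → (∀ b → f b ≈ g b) → ∀ u → evalK f u ≈ evalK g u
  evalK-ext f g e [] = ≈refl
  evalK-ext f g e ((a , b) ∷ u) = +-cong (*-cong ≈refl (e b)) (evalK-ext f g e u)

  evalK-*ʳ : ∀ {B : Set} (f : B → Carrier) k u → evalK (λ b → f b * k) u ≈ evalK f u * k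
  evalK-*ʳ f k [] = ≈sym (zeroˡ k)
  evalK-*ʳ f k ((a , b) ∷ u) =
    ≈trans (+-cong (≈sym (*-assoc a (f b) k)) (evalK-*ʳ f k u)) (≈sym (distribʳ k _ _))

  evalK-*ˡ : ∀ {B : Set} (f : B → Carrier) k u → evalK (λ b → k * f b) u ≈ k * evalK f u
  evalK-*ˡ f k u = ≈trans (evalK-ext _ _ (λ b → *-comm k (f b)) u) (≈trans (evalK-*ʳ f k u) (*-comm _ k))

  εb-mul : ∀ A B → εb (A · B) ≈ εb A * εb B
  εb-mul A B rewrite εb-eq (A · B) | εb-eq A | εb-eq B with size A | size B
  ... | zero | zero = ≈sym (*-identityˡ 1#)
  ... | zero | suc _ = ≈sym (zeroʳ 1#)
  ... | suc _ | _ = ≈sym (zeroˡ _)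

  ε-mul : ∀ u v → ε (mul u v) ≈ ε u * ε v
  ε-mul u v =
    ≈trans (evalK-bind εb (λ F → bind (λ G → basis (F · G)) v) u)
    (≈trans (evalK-ext _ _ (λ F → ≈trans (evalK-bind εb (λ G → basis (F · G)) v)
               (≈trans (evalK-ext _ _ (λ G → ≈trans (+-identityʳ _) (≈trans (*-identityˡ _) (εb-mul F G))) v)
                       (evalK-*ˡ εb (εb F) v))) u)
            (evalK-*ʳ εb (ε v) u))

  deg-Δ : ∀ F → All (λ t → size (proj₁ (proj₂ t)) ℕ.+ size (proj₂ (proj₂ t)) ≡ size F) (Δb F)
  deg-Δ F = AllP.map⁺ (All.tabulate λ {W} _ → count-not (Cuts.leaSet F W))

  deg-ε : ∀ F → size F ≢ 0 → εb F ≈ 0#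
  deg-ε F ne = aux (size F) refl
    where
    aux : ∀ k → size F ≡ k → εb F ≈ 0#
    aux zero e = ⊥-elim (ne e)
    aux (suc k) e = reflexive (εb-size-suc F e)

  heap-Δ : ∀ F → IsHeap F → InSpan _≅₂_ (λ P → IsHeap (proj₁ P) × IsHeap (proj₂ P)) (Δb F)
  heap-Δ F h = Δb F , ≋-refl , AllP.map⁺ (All.tabulate λ {W} _ → heap-induced F _ h , heap-induced F _ h)

  module _ {C : Set} {_∼_ : C → C → Set} where
    private
      _≋_ = Eqv _∼_

    scale-swap : ∀ a x (w : Lin C) → scale a (scale x w) ≋ scale x (scale a w)
    scale-swap a x w = ≋-trans (scale-scale a x w) (≋-trans (scale-coef w (*-comm a x)) (≋-sym (scale-scale x a w)))

    scale-bind : ∀ {B : Set} a (f : B → Lin C) v → scale a (bind f v) ≋ bind (λ c → scale a (f c)) v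
    scale-bind a f [] = ≋-refl
    scale-bind a f ((x , b) ∷ v) =
      ≋-trans (≡⇒≋ (scale-++ {_∼_ = _∼_} a (scale x (f b)) (bind f v))) (≋-++ (scale-swap a x (f b)) (scale-bind a f v))

    bind-nil : ∀ {B : Set} (v : Lin B) → bind (λ _ → []) v ≋ []
    bind-nil [] = ≋-refl
    bind-nil (_ ∷ v) = bind-nil v

    bind-++-pointwise : ∀ {B : Set} (f g : B → Lin C) v → bind (λ c → f c ++ g c) v ≋ (bind f v ++ bind g v)
    bind-++-pointwise f g [] = ≋-refl
    bind-++-pointwise f g ((x , b) ∷ v) =
      ≋-trans (≋-++ (≡⇒≋ (scale-++ {_∼_ = _∼_} x (f b) (g b))) (bind-++-pointwise f g v))
              (≋-mid (scale x (f b)) (scale x (g b)) (bind f v) (bind g v))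

    bind-swap : ∀ {A B : Set} (h : A → B → Lin C) u v →
                bind (λ a → bind (h a) v) u ≋ bind (λ b → bind (λ a → h a b) u) v
    bind-swap h [] v = ≋-sym (bind-nil v)
    bind-swap h ((x , a) ∷ u) v =
      ≋-trans (≋-++ (scale-bind x (h a) v) (bind-swap h u v))
              (≋-sym (bind-++-pointwise (λ b → scale x (h a b)) (λ b → bind (λ a → h a b) u) v))

  mul₂-term : H⊗H → PForest × PForest → H⊗H
  mul₂-term v (F , G) = bind (λ { (F' , G') → [ (1# , (F · F' , G · G')) ] }) v

  mul₂-cong : ∀ {u u' v v'} → u ≈H₂ u' → v ≈H₂ v' → mul₂ u v ≈H₂ mul₂ u' v'
  mul₂-cong {u} {u'} {v} {v'} p q =
    ≋-trans (bind-cong (mul₂-term v)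
          (λ { {F , G} {F' , G'} (φ , ψ) → bind-ext _ _ (λ { (A , B) → ≋-basis 1# (·-cong φ ≅-refl , ·-cong ψ ≅-refl) }) v }) p)
            (bind-ext _ _ (λ { (F , G) → bind-cong _ (λ { (φ , ψ) → ≋-basis 1# (·-cong ≅-refl φ , ·-cong ≅-refl ψ) }) q }) u')

  Δb-· : ∀ F G → Δb (F · G) ≈H₂ mul₂ (Δb F) (Δb G)
  Δb-· F G =
    ≋-trans (Δb≈Δclosed (F · G))
    (≋-trans (concatMap-reindex (Δclosed-term (F · G)) productTerm (λ z → z) (λ { (S , S') → S V.++ S' })
               (Cl.closedSets (F · G)) (pairs (Cl.closedSets F) (λ _ → Cl.closedSets G))
               (subst Unique (P.sym (LP.map-id _)) (Cl.closedSets-unique (F · G)))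
               (UP.map⁺ (λ { {S , S'} {T , T'} e → let a , b = ++-injective S T e in P.cong₂ _,_ a b })
                        (Unique-pairs (Cl.closedSets-unique F) (λ _ → Cl.closedSets-unique G)))
               closed-split closed-join term-split)
    (≋-sym (≋-trans (mul₂-cong (Δb≈Δclosed F) (Δb≈Δclosed G))
           (≋-trans (bind-concatMap-basis (mul₂-term (Δclosed G)) (λ S → induced F S , induced F (∁ S)) (Cl.closedSets F))
           (≋-trans (concatMap-cong _ _ (Cl.closedSets F)
                 (λ {S} _ → bind-concatMap-basis _ (λ S' → induced G S' , induced G (∁ S')) (Cl.closedSets G)))
                    (≡⇒≋ (P.sym (concatMap-pairs productTerm (Cl.closedSets F) (λ _ → Cl.closedSets G)))))))))
    where
    n = size F
    m = size G
    productTerm : Vec Bool n × Vec Bool m → H⊗H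
    productTerm (S , S') = [ (1# , (induced F S · induced G S' , induced F (∁ S) · induced G (∁ S'))) ]
    closed-split : ∀ {X} → X ∈ Cl.closedSets (F · G) →
         Σ _ λ z → z ∈ pairs (Cl.closedSets F) (λ _ → Cl.closedSets G) × (proj₁ z V.++ proj₂ z) ≡ X
    closed-split {X} mX with V.splitAt n X
    ... | S , S' , refl =
      let c , c' = Prod.closed-++⁻ F G S S' (Cl.closed∈ (F · G) mX)
      in (S , S') , ∈-pairs⁺ (Cl.∈closed F c) (Cl.∈closed G c') , refl
    closed-join : ∀ {z} → z ∈ pairs (Cl.closedSets F) (λ _ → Cl.closedSets G) →
         Σ _ λ X → X ∈ Cl.closedSets (F · G) × X ≡ (proj₁ z V.++ proj₂ z)
    closed-join {S , S'} mz = let m1 , m2 = ∈-pairs⁻ {xs = Cl.closedSets F} mz in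
      (S V.++ S') , Cl.∈closed (F · G) (Prod.closed-++ F G S S' (Cl.closed∈ F m1) (Cl.closed∈ G m2)) , refl
    term-split : ∀ {X z} → X ∈ Cl.closedSets (F · G) → z ∈ pairs (Cl.closedSets F) (λ _ → Cl.closedSets G) →
         X ≡ (proj₁ z V.++ proj₂ z) → Δclosed-term (F · G) X ≈H₂ productTerm z
    term-split {z = S , S'} _ _ refl = ≋-basis 1# (≅-sym (induced-· F G S S') ,
      ≅-trans (≡⇒≅ (cong (induced (F · G)) (map-++ not S S'))) (≅-sym (induced-· F G (∁ S) (∁ S'))))

  Δ-mul : ∀ u v → Δ (mul u v) ≈H₂ mul₂ (Δ u) (Δ v)
  Δ-mul u v =
    ≋-trans (bind-bind (λ F → bind (λ G → basis (F · G)) v) Δb u)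
    (≋-trans (bind-ext _ _ (λ F → ≋-trans (bind-bind (λ G → basis (F · G)) Δb v)
                (bind-ext _ _ (λ G → ≋-trans (bind-basis Δb (F · G)) (Δb-· F G)) v)) u)
    (≋-sym (≋-trans (bind-bind Δb (mul₂-term (Δ v)) u)
            (bind-ext _ _ (λ F → ≋-trans (bind-ext _ _ (λ p → bind-bind Δb (mul₂-basis p) v) (Δb F))
                 (bind-swap (λ p G → mul₂-term (Δb G) p) (Δb F) v)) u))))
    where
    mul₂-basis : PForest × PForest → PForest × PForest → H⊗H
    mul₂-basis p q = [ (1# , (proj₁ p · proj₁ q , proj₂ p · proj₂ q)) ]

  relabel : ∀ {B C : Set} → (B → C) → Lin B → Lin C
  relabel k = L.map λ { (x , b) → (x , k b) }

  relabel-cong : ∀ {B C : Set} {_∼_ : B → B → Set} {_∼'_ : C → C → Set} (k : B → C) →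
              (∀ {b b'} → b ∼ b' → k b ∼' k b') → ∀ {u v} → Eqv _∼_ u v → Eqv _∼'_ (relabel k u) (relabel k v)
  relabel-cong k kc ≋-refl = ≋-refl
  relabel-cong k kc (≋-sym p) = ≋-sym (relabel-cong k kc p)
  relabel-cong k kc (≋-trans p q) = ≋-trans (relabel-cong k kc p) (relabel-cong k kc q)
  relabel-cong k kc (≋-++ {u} {u'} {v} {v'} p q) =
    ≋-trans (≡⇒≋ (LP.map-++ _ u v)) (≋-trans (≋-++ (relabel-cong k kc p) (relabel-cong k kc q)) (≡⇒≋ (P.sym (LP.map-++ _ u' v'))))
  relabel-cong k kc (≋-swap x y) = ≋-swap _ _
  relabel-cong k kc (≋-merge a a' b) = ≋-merge a a' (k b)
  relabel-cong k kc (≋-zero b) = ≋-zero (k b)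
  relabel-cong k kc (≋-coef b e) = ≋-coef (k b) e
  relabel-cong k kc (≋-basis a e) = ≋-basis a (kc e)

  relabel-ext : ∀ {B C : Set} {_∼'_ : C → C → Set} (k k' : B → C) → (∀ b → k b ∼' k' b) → ∀ u →
             Eqv _∼'_ (relabel k u) (relabel k' u)
  relabel-ext k k' e [] = ≋-refl
  relabel-ext k k' e ((a , b) ∷ u) = ≋-++ (≋-basis a (e b)) (relabel-ext k k' e u)

  relabel-concatMap-basis : ∀ {X B C : Set} (k : B → C) (p : X → B) xs →
               relabel k (concatMap (λ x → [ (1# , p x) ]) xs) ≡ concatMap (λ x → [ (1# , k (p x)) ]) xs
  relabel-concatMap-basis k p [] = refl
  relabel-concatMap-basis k p (x ∷ xs) = cong (_ ∷_) (relabel-concatMap-basis k p xs)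

  extendʳ : PForest → PForest × PForest → PForest × (PForest × PForest)
  extendʳ G (A , B) = (A , (B , G))
  extendˡ : PForest → PForest × PForest → PForest × (PForest × PForest)
  extendˡ F P = (F , P)

  Δ⊗id-term : PForest × PForest → H⊗H⊗H
  Δ⊗id-term (F , G) = relabel (extendʳ G) (Δb F)
  id⊗Δ-term : PForest × PForest → H⊗H⊗H
  id⊗Δ-term (F , G) = relabel (extendˡ F) (Δb G)

  Δ⊗id-term-cong : ∀ {p q} → p ≅₂ q → Δ⊗id-term p ≈H₃ Δ⊗id-term q
  Δ⊗id-term-cong {F , G} {F' , G'} (φ , ψ) =
    ≋-trans (relabel-cong (extendʳ G) (λ { (α , β) → α , (β , ≅-refl) }) (Δb-cong φ))
            (relabel-ext (extendʳ G) (extendʳ G') (λ _ → ≅-refl , (≅-refl , ψ)) (Δb F'))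
  id⊗Δ-term-cong : ∀ {p q} → p ≅₂ q → id⊗Δ-term p ≈H₃ id⊗Δ-term q
  id⊗Δ-term-cong {F , G} {F' , G'} (φ , ψ) =
    ≋-trans (relabel-cong (extendˡ F) (λ { (α , β) → ≅-refl , (α , β) }) (Δb-cong ψ))
            (relabel-ext (extendˡ F) (extendˡ F') (λ _ → φ , (≅-refl , ≅-refl)) (Δb G'))

  -- Both iterated coproducts are sums over chains S₁ ⊆ S₂ of closed sets: on the left S₂ is cut
  -- first and S₁ appears as a closed subset T of F|S₂, on the right S₁ is cut first and S₂ ∖ S₁
  -- appears as a closed subset U of F|∁S₁.  The maps chainˡ, chainʳ identify both index sets
  -- with these chains, written as pairs (S₂ , S₁).
  module NestedCuts (F : PForest) where
    private
      n = size F
      clsF = Cl.closedSets F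

    lowerPairs : List (Σ (Vec Bool n) λ S → Vec Bool (count S))
    lowerPairs = pairs clsF (λ S₂ → Cl.closedSets (induced F S₂))

    upperPairs : List (Σ (Vec Bool n) λ S → Vec Bool (count (∁ S)))
    upperPairs = pairs clsF (λ S₁ → Cl.closedSets (induced F (∁ S₁)))

    termˡ : Σ (Vec Bool n) (λ S → Vec Bool (count S)) → H⊗H⊗H
    termˡ (S₂ , T) = [ (1# , (induced (induced F S₂) T , (induced (induced F S₂) (∁ T) , induced F (∁ S₂)))) ]

    termʳ : Σ (Vec Bool n) (λ S → Vec Bool (count (∁ S))) → H⊗H⊗H
    termʳ (S₁ , U) = [ (1# , (induced F S₁ , (induced (induced F (∁ S₁)) U , induced (induced F (∁ S₁)) (∁ U)))) ]

    chainˡ : Σ (Vec Bool n) (λ S → Vec Bool (count S)) → Vec Bool n × Vec Bool n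
    chainˡ (S₂ , T) = S₂ , spread S₂ T

    chainʳ : Σ (Vec Bool n) (λ S → Vec Bool (count (∁ S))) → Vec Bool n × Vec Bool n
    chainʳ (S₁ , U) = union S₁ (spread (∁ S₁) U) , S₁

    chainˡ-injective : ∀ {x y} → chainˡ x ≡ chainˡ y → x ≡ y
    chainˡ-injective {S₂ , T} e with cong proj₁ e
    ... | refl = cong (S₂ ,_) (spread-inj S₂ (cong proj₂ e))

    chainʳ-injective : ∀ {x y} → chainʳ x ≡ chainʳ y → x ≡ y
    chainʳ-injective {S₁ , U} {_ , U'} e with cong proj₂ e
    ... | refl = cong (S₁ ,_) (P.trans (P.sym (restrict-union S₁ U))
                               (P.trans (cong (restrict (∁ S₁)) (cong proj₁ e)) (restrict-union S₁ U')))

    lower⇒upper : ∀ {x} → x ∈ lowerPairs → Σ _ λ z → z ∈ upperPairs × chainʳ z ≡ chainˡ x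
    lower⇒upper {S₂ , T} m =
      let m₁ , m₂ = ∈-pairs⁻ {xs = clsF} m
          c₂ = Cl.closed∈ F m₁
          S₁ = spread S₂ T
      in (S₁ , restrict (∁ S₁) S₂) ,
         ∈-pairs⁺ (Cl.∈closed F (ClosedOps.closed-spread F S₂ T c₂ (Cl.closed∈ (induced F S₂) m₂)))
                  (Cl.∈closed (induced F (∁ S₁)) (ClosedOps.closed-restrict F (∁ S₁) S₂ c₂)) ,
         P.cong₂ _,_ (union-restrict S₁ S₂ (spread-sub⊆ S₂ T)) refl

    upper⇒lower : ∀ {z} → z ∈ upperPairs → Σ _ λ x → x ∈ lowerPairs × chainˡ x ≡ chainʳ z
    upper⇒lower {S₁ , U} m =
      let m₁ , m₂ = ∈-pairs⁻ {xs = clsF} m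
          c₁ = Cl.closed∈ F m₁
          S₂ = union S₁ (spread (∁ S₁) U)
          S₁⊆S₂ : ∀ v → lookup S₁ v ≡ true → lookup S₂ v ≡ true
          S₁⊆S₂ v t = P.trans (lookup-union S₁ _ v) (cong (_∨ lookup (spread (∁ S₁) U) v) t)
      in (S₂ , restrict S₂ S₁) ,
         ∈-pairs⁺ (Cl.∈closed F (ClosedOps.closed-union F S₁ U c₁ (Cl.closed∈ (induced F (∁ S₁)) m₂)))
                  (Cl.∈closed (induced F S₂) (ClosedOps.closed-restrict F S₂ S₁ c₁)) ,
         P.cong₂ _,_ refl (spread-restrict S₂ S₁ S₁⊆S₂)

    termˡ≈termʳ : ∀ {x z} → x ∈ lowerPairs → z ∈ upperPairs → chainˡ x ≡ chainʳ z → termˡ x ≈H₃ termʳ z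
    termˡ≈termʳ {S₂ , T} {S₁ , U} _ _ e =
      let e₁ = cong proj₁ e
          e₂ = cong proj₂ e
      in ≋-basis 1#
        (≅-trans (induced-induced F S₂ T) (≡⇒≅ (cong (induced F) e₂)) ,
         (≅-trans (induced-induced F S₂ (∁ T))
            (≅-trans (≡⇒≅ (cong (induced F) (P.trans (spread-∁≡diff S₁ S₂ T (P.sym e₂))
                                                      (P.sym (spread-union≡diff S₁ S₂ U e₁)))))
                     (≅-sym (induced-induced F (∁ S₁) U))) ,
          ≅-trans (≡⇒≅ (cong (induced F) (P.sym (spread-∁≡∁-union S₁ S₂ U e₁))))
                  (≅-sym (induced-induced F (∁ S₁) (∁ U)))))

    Δ⊗id-lowerPairs : Δ⊗id (Δb F) ≈H₃ concatMap termˡ lowerPairs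
    Δ⊗id-lowerPairs =
      ≋-trans (bind-cong Δ⊗id-term Δ⊗id-term-cong (Δb≈Δclosed F))
      (≋-trans (bind-concatMap-basis Δ⊗id-term (λ S → induced F S , induced F (∁ S)) clsF)
      (≋-trans (concatMap-cong _ _ clsF λ {S₂} _ →
                  ≋-trans (relabel-cong (extendʳ (induced F (∁ S₂))) (λ { (α , β) → α , (β , ≅-refl) })
                                        (Δb≈Δclosed (induced F S₂)))
                          (≡⇒≋ (relabel-concatMap-basis (extendʳ (induced F (∁ S₂))) _ (Cl.closedSets (induced F S₂)))))
               (≡⇒≋ (P.sym (concatMap-pairs termˡ clsF (λ S₂ → Cl.closedSets (induced F S₂)))))))

    id⊗Δ-upperPairs : id⊗Δ (Δb F) ≈H₃ concatMap termʳ upperPairs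
    id⊗Δ-upperPairs =
      ≋-trans (bind-cong id⊗Δ-term id⊗Δ-term-cong (Δb≈Δclosed F))
      (≋-trans (bind-concatMap-basis id⊗Δ-term (λ S → induced F S , induced F (∁ S)) clsF)
      (≋-trans (concatMap-cong _ _ clsF λ {S₁} _ →
                  ≋-trans (relabel-cong (extendˡ (induced F S₁)) (λ { (α , β) → ≅-refl , (α , β) })
                                        (Δb≈Δclosed (induced F (∁ S₁))))
                          (≡⇒≋ (relabel-concatMap-basis (extendˡ (induced F S₁)) _ (Cl.closedSets (induced F (∁ S₁))))))
               (≡⇒≋ (P.sym (concatMap-pairs termʳ clsF (λ S₁ → Cl.closedSets (induced F (∁ S₁))))))))

    lowerPairs≈upperPairs : concatMap termˡ lowerPairs ≈H₃ concatMap termʳ upperPairs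
    lowerPairs≈upperPairs = concatMap-reindex termˡ termʳ chainˡ chainʳ lowerPairs upperPairs
      (UP.map⁺ chainˡ-injective (Unique-pairs (Cl.closedSets-unique F) (λ S₂ → Cl.closedSets-unique (induced F S₂))))
      (UP.map⁺ chainʳ-injective (Unique-pairs (Cl.closedSets-unique F) (λ S₁ → Cl.closedSets-unique (induced F (∁ S₁)))))
      lower⇒upper upper⇒lower termˡ≈termʳ

  coassoc-basis : ∀ F → Δ⊗id (Δb F) ≈H₃ id⊗Δ (Δb F)
  coassoc-basis F = ≋-trans Δ⊗id-lowerPairs (≋-trans lowerPairs≈upperPairs (≋-sym id⊗Δ-upperPairs))
    where open NestedCuts F

  coassoc : ∀ u → Δ⊗id (Δ u) ≈H₃ id⊗Δ (Δ u)
  coassoc u = ≋-trans (bind-bind Δb Δ⊗id-term u) (≋-trans (bind-ext _ _ coassoc-basis u) (≋-sym (bind-bind Δb id⊗Δ-term u)))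

  -- Convolution and the antipode

  RespectsIso : (PForest → H) → Set _
  RespectsIso f = ∀ {F G} → F ≅ G → f F ≈H f G

  ηεb : PForest → H
  ηεb F = [ (εb F , emptyF) ]

  conv : (PForest → H) → (PForest → H) → PForest → H
  conv f g F = bind (λ p → mul (f (proj₁ p)) (g (proj₂ p))) (Δb F)

  mul-bindˡ : ∀ {B : Set} (φ : B → H) x y → mul (bind φ x) y ≈H bind (λ b → mul (φ b) y) x
  mul-bindˡ φ x y = bind-bind φ (λ F → bind (λ G → basis (F · G)) y) x

  mul-bindʳ : ∀ {B : Set} (ψ : B → H) x w → mul x (bind ψ w) ≈H bind (λ q → mul x (ψ q)) w
  mul-bindʳ ψ x w =
    ≋-trans (bind-ext _ _ (λ F → bind-bind ψ (λ G → basis (F · G)) w) x)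
            (bind-swap (λ F q → bind (λ G → basis (F · G)) (ψ q)) x w)

  bind-const : ∀ c' (u : H) → bind (λ F → [ (c' , F) ]) u ≈H scale c' u
  bind-const c' [] = ≋-refl
  bind-const c' ((a , F) ∷ u) = ≋-++ (≋-coef F (*-comm a c')) (bind-const c' u)

  mul-emptyʳ : ∀ u c' E → size E ≡ 0 → mul u [ (c' , E) ] ≈H scale c' u
  mul-emptyʳ u c' E e =
    ≋-trans (bind-ext _ _ (λ F → ≋-trans (≡⇒≋ (LP.++-identityʳ _))
               (≋-basis _ (≅-trans (·-cong ≅-refl (size≡0⇒≅ E emptyF e refl)) (·-identityʳ F)))) u)
    (≋-trans (bind-ext _ _ (λ F → ≋-coef F (*-identityʳ c')) u) (bind-const c' u))

  mul-emptyˡ : ∀ u c' E → size E ≡ 0 → mul [ (c' , E) ] u ≈H scale c' u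
  mul-emptyˡ u c' E e =
    ≋-trans (≡⇒≋ (LP.++-identityʳ _))
    (scale-cong c' (≋-trans (bind-ext _ _
          (λ G → ≋-basis 1# (≅-trans (·-cong (size≡0⇒≅ E emptyF e refl) ≅-refl) (·-identityˡ G))) u)
                             (bind-basis-id u)))

  bind-relabel : ∀ {B C D : Set} (t : C → Lin D) (k : B → C) w → bind t (relabel k w) ≡ bind (λ b → t (k b)) w
  bind-relabel t k [] = refl
  bind-relabel t k ((a , b) ∷ w) = cong (scale a (t (k b)) ++_) (bind-relabel t k w)

  conv-identityʳ : ∀ f → RespectsIso f → ∀ F → conv f ηεb F ≈H f F
  conv-identityʳ f fr F =
    ≋-trans (bind-ext _ _ (λ p → ≋-trans (mul-emptyʳ (f (proj₁ p)) (εb (proj₂ p)) emptyF refl)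
                                   (≡⇒≋ (P.sym (LP.++-identityʳ _)))) (Δb F))
    (≋-trans (≋-sym (bind-bind id⊗ε-term f (Δb F)))
    (≋-trans (bind-cong f fr (counit-right-basis F)) (bind-basis f F)))

  conv-identityˡ : ∀ f → RespectsIso f → ∀ F → conv ηεb f F ≈H f F
  conv-identityˡ f fr F =
    ≋-trans (bind-ext _ _ (λ p → ≋-trans (mul-emptyˡ (f (proj₂ p)) (εb (proj₁ p)) emptyF refl)
                                   (≡⇒≋ (P.sym (LP.++-identityʳ _)))) (Δb F))
    (≋-trans (≋-sym (bind-bind ε⊗id-term f (Δb F)))
    (≋-trans (bind-cong f fr (counit-left-basis F)) (bind-basis f F)))

  conv-congʳ : ∀ f g g' → (∀ G → g G ≈H g' G) → ∀ F → conv f g F ≈H conv f g' F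
  conv-congʳ f g g' e F = bind-ext _ _ (λ p → mul-cong {u = f (proj₁ p)} ≋-refl (e (proj₂ p))) (Δb F)

  conv-congˡ : ∀ f f' g → (∀ G → f G ≈H f' G) → ∀ F → conv f g F ≈H conv f' g F
  conv-congˡ f f' g e F = bind-ext _ _ (λ p → mul-cong {v = g (proj₂ p)} (e (proj₁ p)) ≋-refl) (Δb F)

  conv-assoc : ∀ f g h → RespectsIso f → RespectsIso g → RespectsIso h → ∀ F → conv (conv f g) h F ≈H conv f (conv g h) F
  conv-assoc f g h fr gr hr F =
    ≋-trans (bind-ext _ _ (λ p → mul-bindˡ (λ q → mul (f (proj₁ q)) (g (proj₂ q))) (Δb (proj₁ p)) (h (proj₂ p))) (Δb F))
    (≋-trans (bind-ext _ _ (λ p → ≡⇒≋ (P.sym (bind-relabel t (extendʳ (proj₂ p)) (Δb (proj₁ p))))) (Δb F))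
    (≋-trans (≋-sym (bind-bind Δ⊗id-term t (Δb F)))
    (≋-trans (bind-cong t (λ { (α , (β , γ)) → mul-cong (mul-cong (fr α) (gr β)) (hr γ) }) (coassoc-basis F))
    (≋-trans (bind-bind id⊗Δ-term t (Δb F))
    (≋-trans (bind-ext _ _ (λ p → ≡⇒≋ (bind-relabel t (extendˡ (proj₁ p)) (Δb (proj₂ p)))) (Δb F))
    (bind-ext _ _ (λ p → ≋-trans (bind-ext _ _ (λ q → mul-assoc (f (proj₁ p)) (g (proj₁ q)) (h (proj₂ q))) (Δb (proj₂ p)))
                            (≋-sym (mul-bindʳ (λ q → mul (g (proj₁ q)) (h (proj₂ q))) (f (proj₁ p)) (Δb (proj₂ p))))) (Δb F)))))))
    where
    t : PForest × (PForest × PForest) → H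
    t (A , (B , C)) = mul (mul (f A) (g B)) (h C)

  bind-ηε : ∀ u → bind ηεb u ≈H η∘ε u
  bind-ηε u = ≋-trans (aux u) (≋-sym (≋-coef emptyF (*-identityʳ (ε u))))
    where
    aux : ∀ u → bind ηεb u ≈H [ (ε u , emptyF) ]
    aux [] = ≋-sym (≋-zero emptyF)
    aux ((a , F) ∷ u) = ≋-trans (≋-++ {u = [ (a * εb F , emptyF) ]} ≋-refl (aux u)) (≋-merge _ _ emptyF)

  ifZero-split : ∀ n (Z : H) → Z ≈H (ifZero n [] Z ++ ifZero n Z [])
  ifZero-split zero Z = ≋-refl
  ifZero-split (suc _) Z = ≡⇒≋ (P.sym (LP.++-identityʳ Z))

  concatMap-++-pointwise : ∀ {X : Set} (f g : X → H) xs → concatMap (λ x → f x ++ g x) xs ≈H (concatMap f xs ++ concatMap g xs)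
  concatMap-++-pointwise f g [] = ≋-refl
  concatMap-++-pointwise f g (x ∷ xs) = ≋-trans (≋-++ˡ (f x ++ g x) (concatMap-++-pointwise f g xs))
        (≋-mid (f x) (g x) (concatMap f xs) (concatMap g xs))

  ++-negate : ∀ (X : H) → (X ++ scale (- 1#) X) ≈H []
  ++-negate X = ≋-trans (≋-++ʳ (scale (- 1#) X) (≋-sym (scale-1 X)))
            (≋-trans (scale-add 1# (- 1#) X) (≋-trans (scale-coef X (-‿inverseʳ 1#)) (scale-0 X)))

  count-∁-size0 : ∀ F (S : Vec Bool (size F)) → size F ≡ 0 → count (∁ S) ≡ 0
  count-∁-size0 F S e = NP.m+n≡0⇒m≡0 (count (∁ S)) (P.trans (NP.+-comm (count (∁ S)) (count S)) (P.trans (count-not S) e))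

  count-size0 : ∀ F (S : Vec Bool (size F)) → size F ≡ 0 → count S ≡ 0
  count-size0 F S e = NP.m+n≡0⇒m≡0 (count S) (P.trans (count-not S) e)

  -- Sˡ(F) = − Σ Sˡ(F|S) · F|∁S over the closed sets S ≠ V(F): the missing term Sˡ(F) · 1 is the
  -- one the equation Sˡ ⋆ id = ηε is solved for.  The fuel only makes the recursion on the
  -- number of vertices structural.
  Sˡ-term : (PForest → H) → (F : PForest) → Vec Bool (size F) → H
  Sˡ-term T F S = ifZero (count (∁ S)) [] (mul (T (induced F S)) (basis (induced F (∁ S))))

  Sˡ-step : (PForest → H) → PForest → H
  Sˡ-step T F = scale (- 1#) (concatMap (Sˡ-term T F) (Cl.closedSets F))

  Sˡ-fuel : ℕ → PForest → H
  Sˡ-fuel zero F = one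
  Sˡ-fuel (suc k) F = ifZero (size F) one (Sˡ-step (Sˡ-fuel k) F)

  Sˡ : PForest → H
  Sˡ F = Sˡ-fuel (size F) F

  Sˡ-term-cong : ∀ T T' F S → (∀ m → count (∁ S) ≡ suc m → T (induced F S) ≈H T' (induced F S)) → Sˡ-term T F S ≈H Sˡ-term T' F S
  Sˡ-term-cong T T' F S h with zero-or-suc (count (∁ S))
  ... | inj₁ e = ≡⇒≋ (P.trans (ifZero-zero _ _ e) (P.sym (ifZero-zero _ _ e)))
  ... | inj₂ (m , e) = ≋-trans (≡⇒≋ (ifZero-suc [] (mul (T (induced F S)) (basis (induced F (∁ S)))) e))
      (≋-trans (mul-cong {v = basis (induced F (∁ S))} (h m e) ≋-refl)
            (≡⇒≋ (P.sym (ifZero-suc [] (mul (T' (induced F S)) (basis (induced F (∁ S)))) e))))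

  size-lower : ∀ F S {m j} → count (∁ S) ≡ suc m → size F ≤ suc j → size (induced F S) ≤ j
  size-lower F S {m} e le = +-suc≤⇒≤ (count S) m (P.trans (cong (count S ℕ.+_) (P.sym e)) (count-not S)) le

  Sˡ-fuel-irrelevant : ∀ k k' F → size F ≤ k → size F ≤ k' → Sˡ-fuel k F ≈H Sˡ-fuel k' F
  Sˡ-fuel-irrelevant zero zero F _ _ = ≋-refl
  Sˡ-fuel-irrelevant zero (suc k') F le _ = ≡⇒≋ (P.sym (ifZero-zero _ _ (NP.n≤0⇒n≡0 le)))
  Sˡ-fuel-irrelevant (suc k) zero F _ le = ≡⇒≋ (ifZero-zero _ _ (NP.n≤0⇒n≡0 le))
  Sˡ-fuel-irrelevant (suc k) (suc k') F le le' with zero-or-suc (size F)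
  ... | inj₁ e = ≡⇒≋ (P.trans (ifZero-zero _ _ e) (P.sym (ifZero-zero _ _ e)))
  ... | inj₂ (m , e) = ≋-trans (≡⇒≋ (ifZero-suc _ _ e)) (≋-trans
        (scale-cong (- 1#) (concatMap-cong _ _ (Cl.closedSets F) (λ {S} _ → Sˡ-term-cong (Sˡ-fuel k) (Sˡ-fuel k') F S
           (λ m' e' → Sˡ-fuel-irrelevant k k' (induced F S) (size-lower F S e' le) (size-lower F S e' le')))))
        (≡⇒≋ (P.sym (ifZero-suc _ _ e))))

  Sˡ-empty : ∀ F → size F ≡ 0 → Sˡ F ≡ one
  Sˡ-empty F e = cong (λ n → Sˡ-fuel n F) e

  Sˡ-unfold : ∀ F {m} → size F ≡ suc m → Sˡ F ≈H Sˡ-step Sˡ F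
  Sˡ-unfold F {m} e =
    ≋-trans (≡⇒≋ (P.trans (cong (λ n → Sˡ-fuel n F) e) (ifZero-suc _ _ e)))
    (scale-cong (- 1#) (concatMap-cong _ _ (Cl.closedSets F) (λ {S} _ → Sˡ-term-cong (Sˡ-fuel m) Sˡ F S
       (λ m' e' → Sˡ-fuel-irrelevant m (size (induced F S)) (induced F S) (size-lower F S e' (NP.≤-reflexive e)) NP.≤-refl))))

  Sˡ-fuel-cong : ∀ k F G → size F ≤ k → F ≅ G → Sˡ-fuel k F ≈H Sˡ-fuel k G
  Sˡ-fuel-cong zero F G _ φ = ≋-refl
  Sˡ-fuel-cong (suc k) F G le φ with zero-or-suc (size F)
  ... | inj₁ e = ≡⇒≋ (P.trans (ifZero-zero _ _ e) (P.sym (ifZero-zero _ _ (P.trans (P.sym (iso-size φ)) e))))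
  ... | inj₂ (m , e) = ≋-trans (≡⇒≋ (ifZero-suc _ _ e)) (≋-trans
        (scale-cong (- 1#) (closedSets-transport φ _ _ (λ S _ → tc S)))
        (≡⇒≋ (P.sym (ifZero-suc _ _ (P.trans (P.sym (iso-size φ)) e)))))
    where
    tc : ∀ S → Sˡ-term (Sˡ-fuel k) F S ≈H Sˡ-term (Sˡ-fuel k) G (transport φ S)
    tc S with zero-or-suc (count (∁ S))
    ... | inj₁ e' = ≡⇒≋ (P.trans (ifZero-zero _ _ e') (P.sym (ifZero-zero _ _ (P.trans (P.sym cnt) e'))))
      where
      cnt = iso-size (≅-trans (induced-iso φ (∁ S)) (≡⇒≅ (cong (induced G) (transport-∁ φ S))))
    ... | inj₂ (m' , e') = ≋-trans (≡⇒≋ (ifZero-suc _ _ e'))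
        (≋-trans (mul-cong (Sˡ-fuel-cong k (induced F S) _ (size-lower F S e' le) (induced-iso φ S)) (≋-basis 1# ψ))
                 (≡⇒≋ (P.sym (ifZero-suc _ _ (P.trans (P.sym (iso-size ψ)) e')))))
      where
      ψ : induced F (∁ S) ≅ induced G (∁ (transport φ S))
      ψ = ≅-trans (induced-iso φ (∁ S)) (≡⇒≅ (cong (induced G) (transport-∁ φ S)))

  Sˡ-cong : ∀ {F G} → F ≅ G → Sˡ F ≈H Sˡ G
  Sˡ-cong {F} {G} φ = ≋-trans (Sˡ-fuel-cong (size F) F G NP.≤-refl φ) (≡⇒≋ (cong (λ n → Sˡ-fuel n G) (iso-size φ)))

  Sˡ-root : (F : PForest) → Vec Bool (size F) → H
  Sˡ-root F S = ifZero (count (∁ S)) (mul (Sˡ (induced F S)) (basis (induced F (∁ S)))) []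

  -- The term of the full cut S = V(F) is Sˡ(F) itself; for F ≠ 1 the remaining terms add up to
  -- −Sˡ(F) by the defining recursion.
  Sˡ-antipode : ∀ F → conv Sˡ basis F ≈H ηεb F
  Sˡ-antipode F =
    ≋-trans (bind-cong (λ p → mul (Sˡ (proj₁ p)) (basis (proj₂ p))) (λ { (φ , ψ) → mul-cong (Sˡ-cong φ) (≋-basis 1# ψ) })
          (Δb≈Δclosed F))
    (≋-trans (bind-concatMap-basis (λ p → mul (Sˡ (proj₁ p)) (basis (proj₂ p))) (λ S → induced F S , induced F (∁ S)) clsF)
    (≋-trans (concatMap-cong _ _ clsF (λ {S} _ → ifZero-split (count (∁ S)) (mul (Sˡ (induced F S)) (basis (induced F (∁ S))))))
    (≋-trans (concatMap-++-pointwise (Sˡ-term Sˡ F) (Sˡ-root F) clsF)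
    (≋-trans (≋-++ˡ (concatMap (Sˡ-term Sˡ F) clsF)
               (≋-trans (concatMap-single (Sˡ-root F) clsF (full _) (Cl.closedSets-unique F) full∈ nonExtremal) fullCut))
    (cancels (zero-or-suc (size F)))))))
    where
    clsF = Cl.closedSets F
    full∈ : full (size F) ∈ clsF
    full∈ = Cl.∈closed F (λ u v r t → lookup-replicate u true)
    nonExtremal : ∀ {S} → S ∈ clsF → S ≢ full _ → Sˡ-root F S ≈H []
    nonExtremal {S} _ ne = let v , t = ∁-nonempty S ne in
      ≡⇒≋ (ifZero-suc (mul (Sˡ (induced F S)) (basis (induced F (∁ S)))) [] (proj₂ (count-nonzero (∁ S) v t)))
    c0 : count (∁ (full (size F))) ≡ 0
    c0 = P.trans (cong count (∁-full (size F))) (count-∅ (size F))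
    fullCut : Sˡ-root F (full _) ≈H Sˡ F
    fullCut = ≋-trans (≡⇒≋ (ifZero-zero (mul (Sˡ (induced F (full _))) (basis (induced F (∁ (full _))))) [] c0))
      (≋-trans (mul-cong {v = basis (induced F (∁ (full _)))}
            (Sˡ-cong (≅-sym (induced-all F (full _) (λ v → lookup-replicate v true)))) ≋-refl)
      (≋-trans (mul-emptyʳ (Sˡ F) 1# (induced F (∁ (full _))) c0) (scale-1 (Sˡ F))))
    X = concatMap (Sˡ-term Sˡ F) clsF
    cancels : (size F ≡ 0 ⊎ Σ ℕ λ m → size F ≡ suc m) → (X ++ Sˡ F) ≈H ηεb F
    cancels (inj₂ (m , e)) = ≋-trans (≋-++ˡ X (Sˡ-unfold F e))
      (≋-trans (++-negate X) (≋-sym (≋-trans (≋-coef emptyF (reflexive (εb-size-suc F e))) (≋-zero emptyF))))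
    cancels (inj₁ e) = ≋-trans (≋-++ʳ (Sˡ F) (concatMap-≋[] (Sˡ-term Sˡ F) clsF
                        (λ {S} _ → ≡⇒≋ (ifZero-zero [] (mul (Sˡ (induced F S)) (basis (induced F (∁ S))))
                              (count-∁-size0 F S e)))))
      (≋-trans (≡⇒≋ (Sˡ-empty F e)) (≋-coef emptyF (≈sym (reflexive (εb-size0 F e)))))

  Sʳ-term : (PForest → H) → (F : PForest) → Vec Bool (size F) → H
  Sʳ-term T F S = ifZero (count S) [] (mul (basis (induced F S)) (T (induced F (∁ S))))

  Sʳ-step : (PForest → H) → PForest → H
  Sʳ-step T F = scale (- 1#) (concatMap (Sʳ-term T F) (Cl.closedSets F))

  Sʳ-fuel : ℕ → PForest → H
  Sʳ-fuel zero F = one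
  Sʳ-fuel (suc k) F = ifZero (size F) one (Sʳ-step (Sʳ-fuel k) F)

  Sʳ : PForest → H
  Sʳ F = Sʳ-fuel (size F) F

  Sʳ-term-cong : ∀ T T' F S → (∀ m → count S ≡ suc m → T (induced F (∁ S)) ≈H T' (induced F (∁ S))) → Sʳ-term T F S ≈H
        Sʳ-term T' F S
  Sʳ-term-cong T T' F S h with zero-or-suc (count S)
  ... | inj₁ e = ≡⇒≋ (P.trans (ifZero-zero _ _ e) (P.sym (ifZero-zero _ _ e)))
  ... | inj₂ (m , e) = ≋-trans (≡⇒≋ (ifZero-suc [] (mul (basis (induced F S)) (T (induced F (∁ S)))) e))
      (≋-trans (mul-cong {u = basis (induced F S)} ≋-refl (h m e))
            (≡⇒≋ (P.sym (ifZero-suc [] (mul (basis (induced F S)) (T' (induced F (∁ S)))) e))))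

  size-upper : ∀ F S {m j} → count S ≡ suc m → size F ≤ suc j → size (induced F (∁ S)) ≤ j
  size-upper F S {m} e le = suc-+≤⇒≤ m (count (∁ S)) (P.trans (cong (ℕ._+ count (∁ S)) (P.sym e)) (count-not S)) le

  Sʳ-fuel-irrelevant : ∀ k k' F → size F ≤ k → size F ≤ k' → Sʳ-fuel k F ≈H Sʳ-fuel k' F
  Sʳ-fuel-irrelevant zero zero F _ _ = ≋-refl
  Sʳ-fuel-irrelevant zero (suc k') F le _ = ≡⇒≋ (P.sym (ifZero-zero _ _ (NP.n≤0⇒n≡0 le)))
  Sʳ-fuel-irrelevant (suc k) zero F _ le = ≡⇒≋ (ifZero-zero _ _ (NP.n≤0⇒n≡0 le))
  Sʳ-fuel-irrelevant (suc k) (suc k') F le le' with zero-or-suc (size F)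
  ... | inj₁ e = ≡⇒≋ (P.trans (ifZero-zero _ _ e) (P.sym (ifZero-zero _ _ e)))
  ... | inj₂ (m , e) = ≋-trans (≡⇒≋ (ifZero-suc _ _ e)) (≋-trans
        (scale-cong (- 1#) (concatMap-cong _ _ (Cl.closedSets F) (λ {S} _ → Sʳ-term-cong (Sʳ-fuel k) (Sʳ-fuel k') F S
           (λ m' e' → Sʳ-fuel-irrelevant k k' (induced F (∁ S)) (size-upper F S e' le) (size-upper F S e' le')))))
        (≡⇒≋ (P.sym (ifZero-suc _ _ e))))

  Sʳ-empty : ∀ F → size F ≡ 0 → Sʳ F ≡ one
  Sʳ-empty F e = cong (λ n → Sʳ-fuel n F) e

  Sʳ-unfold : ∀ F {m} → size F ≡ suc m → Sʳ F ≈H Sʳ-step Sʳ F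
  Sʳ-unfold F {m} e =
    ≋-trans (≡⇒≋ (P.trans (cong (λ n → Sʳ-fuel n F) e) (ifZero-suc _ _ e)))
    (scale-cong (- 1#) (concatMap-cong _ _ (Cl.closedSets F) (λ {S} _ → Sʳ-term-cong (Sʳ-fuel m) Sʳ F S
       (λ m' e' → Sʳ-fuel-irrelevant m (size (induced F (∁ S))) (induced F (∁ S)) (size-upper F S e' (NP.≤-reflexive e))
             NP.≤-refl))))

  Sʳ-fuel-cong : ∀ k F G → size F ≤ k → F ≅ G → Sʳ-fuel k F ≈H Sʳ-fuel k G
  Sʳ-fuel-cong zero F G _ φ = ≋-refl
  Sʳ-fuel-cong (suc k) F G le φ with zero-or-suc (size F)
  ... | inj₁ e = ≡⇒≋ (P.trans (ifZero-zero _ _ e) (P.sym (ifZero-zero _ _ (P.trans (P.sym (iso-size φ)) e))))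
  ... | inj₂ (m , e) = ≋-trans (≡⇒≋ (ifZero-suc _ _ e)) (≋-trans
        (scale-cong (- 1#) (closedSets-transport φ _ _ (λ S _ → tc S)))
        (≡⇒≋ (P.sym (ifZero-suc _ _ (P.trans (P.sym (iso-size φ)) e)))))
    where
    tc : ∀ S → Sʳ-term (Sʳ-fuel k) F S ≈H Sʳ-term (Sʳ-fuel k) G (transport φ S)
    tc S with zero-or-suc (count S)
    ... | inj₁ e' = ≡⇒≋ (P.trans (ifZero-zero _ _ e') (P.sym (ifZero-zero _ _ (P.trans (P.sym (iso-size (induced-iso φ S))) e'))))
    ... | inj₂ (m' , e') = ≋-trans (≡⇒≋ (ifZero-suc _ _ e'))
        (≋-trans (mul-cong (≋-basis 1# (induced-iso φ S)) (Sʳ-fuel-cong k (induced F (∁ S)) _ (size-upper F S e' le) ψ))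
                 (≡⇒≋ (P.sym (ifZero-suc _ _ (P.trans (P.sym (iso-size (induced-iso φ S))) e')))))
      where
      ψ : induced F (∁ S) ≅ induced G (∁ (transport φ S))
      ψ = ≅-trans (induced-iso φ (∁ S)) (≡⇒≅ (cong (induced G) (transport-∁ φ S)))

  Sʳ-cong : ∀ {F G} → F ≅ G → Sʳ F ≈H Sʳ G
  Sʳ-cong {F} {G} φ = ≋-trans (Sʳ-fuel-cong (size F) F G NP.≤-refl φ) (≡⇒≋ (cong (λ n → Sʳ-fuel n G) (iso-size φ)))

  Sʳ-root : (F : PForest) → Vec Bool (size F) → H
  Sʳ-root F S = ifZero (count S) (mul (basis (induced F S)) (Sʳ (induced F (∁ S)))) []

  Sʳ-antipode : ∀ F → conv basis Sʳ F ≈H ηεb F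
  Sʳ-antipode F =
    ≋-trans (bind-cong (λ p → mul (basis (proj₁ p)) (Sʳ (proj₂ p))) (λ { (φ , ψ) → mul-cong (≋-basis 1# φ) (Sʳ-cong ψ) })
          (Δb≈Δclosed F))
    (≋-trans (bind-concatMap-basis (λ p → mul (basis (proj₁ p)) (Sʳ (proj₂ p))) (λ S → induced F S , induced F (∁ S)) clsF)
    (≋-trans (concatMap-cong _ _ clsF (λ {S} _ → ifZero-split (count S) (mul (basis (induced F S)) (Sʳ (induced F (∁ S))))))
    (≋-trans (concatMap-++-pointwise (Sʳ-term Sʳ F) (Sʳ-root F) clsF)
    (≋-trans (≋-++ˡ (concatMap (Sʳ-term Sʳ F) clsF)
               (≋-trans (concatMap-single (Sʳ-root F) clsF (∅ _) (Cl.closedSets-unique F) ∅∈ nonExtremal) emptyCut))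
    (cancels (zero-or-suc (size F)))))))
    where
    clsF = Cl.closedSets F
    ∅∈ : ∅ (size F) ∈ clsF
    ∅∈ = Cl.∈closed F (λ u v r t → ⊥-elim (true≢false (P.trans (P.sym t) (lookup-replicate v false))))
    nonExtremal : ∀ {S} → S ∈ clsF → S ≢ ∅ _ → Sʳ-root F S ≈H []
    nonExtremal {S} _ ne with ∅-or-member S
    ... | inj₁ e = ⊥-elim (ne e)
    ... | inj₂ (v , t) = ≡⇒≋ (ifZero-suc (mul (basis (induced F S)) (Sʳ (induced F (∁ S)))) [] (proj₂ (count-nonzero S v t)))
    c0 : count (∅ (size F)) ≡ 0
    c0 = count-∅ (size F)
    emptyCut : Sʳ-root F (∅ _) ≈H Sʳ F
    emptyCut = ≋-trans (≡⇒≋ (ifZero-zero (mul (basis (induced F (∅ _))) (Sʳ (induced F (∁ (∅ _))))) [] c0))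
      (≋-trans (mul-cong {u = basis (induced F (∅ _))} ≋-refl (Sʳ-cong (≅-sym (induced-all F (∁ (∅ _)) (lookup-∁-∅ _)))))
      (≋-trans (mul-emptyˡ (Sʳ F) 1# (induced F (∅ _)) c0) (scale-1 (Sʳ F))))
    X = concatMap (Sʳ-term Sʳ F) clsF
    cancels : (size F ≡ 0 ⊎ Σ ℕ λ m → size F ≡ suc m) → (X ++ Sʳ F) ≈H ηεb F
    cancels (inj₂ (m , e)) = ≋-trans (≋-++ˡ X (Sʳ-unfold F e))
      (≋-trans (++-negate X) (≋-sym (≋-trans (≋-coef emptyF (reflexive (εb-size-suc F e))) (≋-zero emptyF))))
    cancels (inj₁ e) = ≋-trans (≋-++ʳ (Sʳ F) (concatMap-≋[] (Sʳ-term Sʳ F) clsF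
                        (λ {S} _ → ≡⇒≋ (ifZero-zero [] (mul (basis (induced F S)) (Sʳ (induced F (∁ S)))) (count-size0 F S e)))))
      (≋-trans (≡⇒≋ (Sʳ-empty F e)) (≋-coef emptyF (≈sym (reflexive (εb-size0 F e)))))

  module _ {B : Set} {_∼_ : B → B → Set} {Pr : B → Set} where
    span-[] : InSpan _∼_ Pr []
    span-[] = [] , ≋-refl , []

    span-++ : ∀ {u v} → InSpan _∼_ Pr u → InSpan _∼_ Pr v → InSpan _∼_ Pr (u ++ v)
    span-++ (w1 , e1 , a1) (w2 , e2 , a2) = w1 ++ w2 , ≋-++ e1 e2 , AllP.++⁺ a1 a2

    all-scale : ∀ a {w : Lin B} → All (λ t → Pr (proj₂ t)) w → All (λ t → Pr (proj₂ t)) (scale a w)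
    all-scale a [] = []
    all-scale a (p ∷ ps) = p ∷ all-scale a ps

    span-scale : ∀ a {u} → InSpan _∼_ Pr u → InSpan _∼_ Pr (scale a u)
    span-scale a (w , e , al) = scale a w , scale-cong a e , all-scale a al

    span-≈ : ∀ {u u'} → Eqv _∼_ u u' → InSpan _∼_ Pr u' → InSpan _∼_ Pr u
    span-≈ e (w , e' , al) = w , ≋-trans e e' , al

    span-concatMap : ∀ {X : Set} (f : X → Lin B) xs → (∀ x → InSpan _∼_ Pr (f x)) → InSpan _∼_ Pr (concatMap f xs)
    span-concatMap f [] h = span-[]
    span-concatMap f (x ∷ xs) h = span-++ (h x) (span-concatMap f xs h)

    span-ifZero : ∀ n {x y} → InSpan _∼_ Pr x → InSpan _∼_ Pr y → InSpan _∼_ Pr (ifZero n x y)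
    span-ifZero zero p q = p
    span-ifZero (suc _) p q = q

  All-mul-basis : ∀ {Pr Q : PForest → Set} (w : H) G → All (λ t → Pr (proj₂ t)) w →
                  (∀ A → Pr A → Q (A · G)) → All (λ t → Q (proj₂ t)) (mul w (basis G))
  All-mul-basis [] G [] h = []
  All-mul-basis ((a , F) ∷ w) G (p ∷ ps) h = h F p ∷ All-mul-basis w G ps h

  span-mul-basis : ∀ {Pr Q : PForest → Set} {u} G → InSpan _≅_ Pr u → (∀ A → Pr A → Q (A · G)) → InSpan _≅_ Q (mul u (basis G))
  span-mul-basis G (w , e , al) h = mul w (basis G) , mul-cong {v = basis G} e ≋-refl , All-mul-basis w G al h

  Sˡ-fuel-homogeneous : ∀ k F → size F ≤ k → InSpan _≅_ (λ G → size G ≡ size F) (Sˡ-fuel k F)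
  Sˡ-fuel-homogeneous zero F le = one , ≋-refl , P.sym (NP.n≤0⇒n≡0 le) ∷ []
  Sˡ-fuel-homogeneous (suc k) F le with zero-or-suc (size F)
  ... | inj₁ e = span-≈ (≡⇒≋ (ifZero-zero _ _ e)) (one , ≋-refl , P.sym e ∷ [])
  ... | inj₂ (m , e) = span-≈ (≡⇒≋ (ifZero-suc _ _ e)) (span-scale (- 1#) (span-concatMap _ (Cl.closedSets F) tm))
    where
    tm : ∀ S → InSpan _≅_ (λ G → size G ≡ size F) (Sˡ-term (Sˡ-fuel k) F S)
    tm S with zero-or-suc (count (∁ S))
    ... | inj₁ e' = span-≈ (≡⇒≋ (ifZero-zero [] (mul (Sˡ-fuel k (induced F S)) (basis (induced F (∁ S)))) e')) span-[]
    ... | inj₂ (m' , e') = span-≈ (≡⇒≋ (ifZero-suc [] (mul (Sˡ-fuel k (induced F S)) (basis (induced F (∁ S)))) e'))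
          (span-mul-basis (induced F (∁ S)) (Sˡ-fuel-homogeneous k (induced F S) (size-lower F S e' le))
            (λ A eA → P.trans (cong (ℕ._+ count (∁ S)) eA) (count-not S)))

  Sˡ-fuel-heap : ∀ k F → IsHeap F → InSpan _≅_ IsHeap (Sˡ-fuel k F)
  Sˡ-fuel-heap zero F h = one , ≋-refl , (λ ()) ∷ []
  Sˡ-fuel-heap (suc k) F h = span-ifZero (size F) (one , ≋-refl , (λ ()) ∷ [])
    (span-scale (- 1#) (span-concatMap _ (Cl.closedSets F) λ S →
      span-ifZero (count (∁ S)) span-[]
        (span-mul-basis (induced F (∁ S)) (Sˡ-fuel-heap k (induced F S) (heap-induced F S h))
          (λ A hA → Prod.heap-· A (induced F (∁ S)) hA (heap-induced F (∁ S) h)))))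

  -- Sˡ = Sˡ ⋆ (id ⋆ Sʳ) = (Sˡ ⋆ id) ⋆ Sʳ = Sʳ.
  Sˡ≈Sʳ : ∀ F → Sˡ F ≈H Sʳ F
  Sˡ≈Sʳ F =
    ≋-trans (≋-sym (conv-identityʳ Sˡ Sˡ-cong F))
    (≋-trans (conv-congʳ Sˡ ηεb (conv basis Sʳ) (λ G → ≋-sym (Sʳ-antipode G)) F)
    (≋-trans (≋-sym (conv-assoc Sˡ basis Sʳ Sˡ-cong (≋-basis 1#) Sʳ-cong F))
    (≋-trans (conv-congˡ (conv Sˡ basis) ηεb Sʳ Sˡ-antipode F) (conv-identityˡ Sʳ Sʳ-cong F))))

  Sˡ-left-antipode : ∀ u → m∘S⊗id Sˡ (Δ u) ≈H η∘ε u
  Sˡ-left-antipode u = ≋-trans (bind-bind Δb _ u) (≋-trans (bind-ext _ _ Sˡ-antipode u) (bind-ηε u))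

  Sˡ-right-antipode : ∀ u → m∘id⊗S Sˡ (Δ u) ≈H η∘ε u
  Sˡ-right-antipode u =
    ≋-trans (bind-bind Δb _ u)
    (≋-trans (bind-ext _ _ (λ F → ≋-trans (conv-congʳ basis Sˡ Sʳ Sˡ≈Sʳ F) (Sʳ-antipode F)) u) (bind-ηε u))

  Sˡ-homogeneous : ∀ F → InSpan _≅_ (λ G → size G ≡ size F) (Sˡ F)
  Sˡ-homogeneous F = Sˡ-fuel-homogeneous (size F) F NP.≤-refl

  Sˡ-heap : ∀ F → IsHeap F → InSpan _≅_ IsHeap (Sˡ F)
  Sˡ-heap F = Sˡ-fuel-heap (size F) F

  hopfAlgebra : Theorem
  hopfAlgebra = record
    { mul-cong = mul-cong ; Δ-cong = Δ-cong ; ε-cong = ε-cong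
    ; mul-assoc = mul-assoc ; one-left = one-left ; one-right = one-right
    ; coassoc = coassoc ; counit-left = counit-left ; counit-right = counit-right
    ; Δ-mul = Δ-mul ; Δ-one = Δ-one ; ε-mul = ε-mul ; ε-one = ε-one
    ; deg-mul = λ F G → refl ; deg-one = refl ; deg-Δ = deg-Δ ; deg-ε = deg-ε
    ; heap-one = λ ()
    ; heap-mul = Prod.heap-·
    ; heap-Δ = heap-Δ
    ; antipode = Sˡ , (λ F G → Sˡ-cong) , Sˡ-left-antipode , Sˡ-right-antipode , Sˡ-homogeneous , Sˡ-heap
    }

mainTheorem1 : ∀ {c ℓ} (K : CommutativeRing c ℓ) → IsField K → CharacteristicZero K →
    HPO.Theorem K
mainTheorem1 K _ _ = hopfAlgebra K
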